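{- For integers $l\ge0$, $k\ge0$ let $H_{l,k}(x)=\sum_{n\ge l+1}\frac{p^{\,n+k-l}_{n,n+k;\le n+k}}{(n-1)!}x^n$. Then $H_{0,k}(x)=x[P(x)]^{k+1}$, and for every $l\ge1$ $$H_{l,k}(x)=H_{l-1,k}(x)-\frac{p^1_{l,l+k;\le l+k}}{(l-1)!}x^l+\frac{p_l}{l!}x^{l+1}[P(x)]^{k+1}.$$
   Context: Parking model: there are $m$ parking spaces in a line, numbered $1,\dots,m$. A preference set of length $n$ is a sequence $(a_1,\dots,a_n)$ of integers with $1\le a_i\le m$; cars $1,\dots,n$ arrive in order, car $i$ parks in the first unoccupied space numbered $\ge a_i$ if one exists, otherwise it fails to park. A parking function is a preference set in which all cars park. $p^r_{n,m;\le s}$ denotes the number of parking functions of length $n$ with $m$ spaces, all entries $\le s$, and $a_1=r$. $p_l=(l+1)^{l-1}$ is the number of parking functions of length $l$ with $l$ spaces. $P(x)=\sum_{n\ge0}\frac{(n+1)^{n-1}}{n!}x^n$. -}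

module Defs where

open import Data.Nat using (ℕ; zero; suc; _∸_; _^_; _!; _≤ᵇ_; _≡ᵇ_)
open import Data.Nat.Properties using (_!≢0)
open import Data.Bool using (Bool; true; false; _∧_; if_then_else_)
open import Data.List using (List; []; _∷_; length; filter; map; concatMap; replicate)
open import Data.Maybe using (Maybe; just; nothing)
import Data.Maybe as Maybe
open import Data.Integer using (ℤ; +_)
open import Data.Rational using (ℚ; _/_; _+_; _-_; _*_; 0ℚ; 1ℚ)
open import Relation.Nullary.Decidable using (does)
open import Relation.Unary using (Decidable)
open import Relation.Binary.PropositionalEquality using (_≡_)
import Data.Bool as B

-- Occupancy of spaces 1..m is a list of m booleans (true = occupied).
-- 'park occ a' parks a car with preference a (1-based) in the first
-- unoccupied space numbered ≥ a; 'nothing' if it fails.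
park : List Bool → ℕ → Maybe (List Bool)
park []           _               = nothing
park (b ∷ bs)     zero            = nothing   -- preference 0 is not a valid preference
park (false ∷ bs) (suc zero)      = just (true ∷ bs)
park (true ∷ bs)  (suc zero)      = Maybe.map (true ∷_) (park bs 1)
park (b ∷ bs)     (suc (suc a))   = Maybe.map (b ∷_) (park bs (suc a))

allPark : List Bool → List ℕ → Bool
allPark occ []       = true
allPark occ (a ∷ as) with park occ a
... | nothing   = false
... | just occ' = allPark occ' as

isParkingFunction : ℕ → List ℕ → Bool
isParkingFunction m as = allPark (replicate m false) as

range1 : ℕ → List ℕ
range1 zero    = []
range1 (suc s) = range1 s Data.List.++ (suc s ∷ [])

seqs : ℕ → ℕ → List (List ℕ)
seqs zero    s = [] ∷ []
seqs (suc n) s = concatMap (λ a → map (a ∷_) (seqs n s)) (range1 s)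

firstIs : ℕ → List ℕ → Bool
firstIs r []      = false
firstIs r (a ∷ _) = r ≡ᵇ a

isPrefSet : ℕ → List ℕ → Bool
isPrefSet m []       = true
isPrefSet m (a ∷ as) = (1 ≤ᵇ a) ∧ (a ≤ᵇ m) ∧ isPrefSet m as

-- p^r_{n,m;≤s}: number of parking functions of length n, m spaces,
-- all entries ≤ s, and a₁ = r.
pPF : (r n m s : ℕ) → ℕ
pPF r n m s = length (filter (λ as → B.T? (firstIs r as ∧ isPrefSet m as ∧ isParkingFunction m as)) (seqs n s))

pL : ℕ → ℕ
pL l = suc l ^ (l ∸ 1)

Series : Set
Series = ℕ → ℚ

inv! : ℕ → ℚ
inv! n = (+ 1) / (n !)
  where instance _ = n !≢0

_⊕_ : Series → Series → Series
(f ⊕ g) n = f n + g n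

_⊖_ : Series → Series → Series
(f ⊖ g) n = f n - g n

sumTo : ℕ → (ℕ → ℚ) → ℚ
sumTo zero    f = f 0
sumTo (suc n) f = sumTo n f + f (suc n)

_⊛_ : Series → Series → Series
(f ⊛ g) n = sumTo n (λ i → f i * g (n ∸ i))

oneS : Series
oneS zero    = 1ℚ
oneS (suc _) = 0ℚ

_^S_ : Series → ℕ → Series
f ^S zero  = oneS
f ^S suc k = f ⊛ (f ^S k)

mono : ℚ → ℕ → Series
mono c j n = if j ≡ᵇ n then c else 0ℚ

shiftS : ℕ → Series → Series
shiftS j f n = if j ≤ᵇ n then f (n ∸ j) else 0ℚ

-- P(x) = Σ_{n≥0} (n+1)^(n-1)/n! xⁿ   (the n=0 coefficient is 1)
Pser : Series
Pser n = (+ (suc n ^ (n ∸ 1))) / 1 * inv! n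

H : ℕ → ℕ → Series
H l k n = if suc l ≤ᵇ n
            then (+ pPF ((n Data.Nat.+ k) ∸ l) n (n Data.Nat.+ k) (n Data.Nat.+ k)) / 1 * inv! (n ∸ 1)
            else 0ℚ

-- The coefficient of x^(j+1) in H_{l,k} counts the parking sequences of j + 1 cars on m = j + k + 1
-- spaces whose first car prefers r = j + k + 1 − l.  The outcome of parking does not depend on the
-- order in which two cars arrive, so that car may park last, and it succeeds iff some space at or after
-- r is free.  Hence lowering r by one adds the sequences of j cars after which space r is the last free
-- one; cutting the lot at that space makes them shuffles of a parking sequence on the left and one that
-- exactly fills the l spaces on the right, which gives p^r − p^(r+1) = C(j, j−l) · p(j−l+k, j−l) · p_l,
-- the coefficient of the new term.  Summing over r shows that j! [x^j] P(x)^(k+1) is the number of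
-- parking sequences of j cars on j + k spaces, and p_l = (l+1)^(l−1) is Pollak's circular argument.

module Submission where

module Counting where

  open import Data.Nat
  open import Data.Nat.Properties
  open import Data.Nat.Combinatorics
    using (_C_; nCn≡1; nCk≡n!/k![n-k]!; k![n∸k]!∣n!; k>n⇒nCk≡0; nCk+nC[k+1]≡[n+1]C[k+1])
  open import Data.Nat.DivMod using (m/n*n≡m)
  open import Data.Nat.Tactic.RingSolver using (solve-∀)
  open import Relation.Binary.PropositionalEquality
  open import Relation.Nullary using (yes; no; contradiction)
  open import Data.Bool using (Bool; true; false; if_then_else_; _∧_; T?)
  open import Data.Bool.Properties using (T-≡; ∧-zeroʳ)
  open import Function.Bundles using (Equivalence)
  open import Data.List using (List; []; _∷_; length; _++_; replicate; filter; map; concatMap)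
  open import Data.Maybe using (Maybe; just; nothing; _>>=_; _<∣>_)
  import Data.Maybe as Maybe
  open import Data.List.Properties using (length-replicate; length-++; filter-++; concatMap-++; ++-identityʳ)
  open import Data.Maybe.Properties using (just-injective; map-id; map-∘; <∣>-idem)
  open import Data.Sum using (_⊎_; inj₁; inj₂)
  open import Data.Product using (Σ; _,_; _×_; proj₁; proj₂)
  open import Function using (const)
  open import Defs using (park; pL; allPark; isPrefSet; range1; seqs; firstIs; pPF)
  open ≡-Reasoning

  -- Finite sums and binomial convolution

  Σ< : ℕ → (ℕ → ℕ) → ℕ
  Σ< zero    f = 0
  Σ< (suc n) f = Σ< n f + f n

  Σ-cong : ∀ n {f g : ℕ → ℕ} → (∀ i → i < n → f i ≡ g i) → Σ< n f ≡ Σ< n g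
  Σ-cong zero    h = refl
  Σ-cong (suc n) h = cong₂ _+_ (Σ-cong n (λ i i<n → h i (m<n⇒m<1+n i<n))) (h n ≤-refl)

  Σ-ext : ∀ n {f g : ℕ → ℕ} → (∀ i → f i ≡ g i) → Σ< n f ≡ Σ< n g
  Σ-ext n h = Σ-cong n (λ i _ → h i)

  Σ-zero : ∀ n {f : ℕ → ℕ} → (∀ i → i < n → f i ≡ 0) → Σ< n f ≡ 0
  Σ-zero zero    h = refl
  Σ-zero (suc n) h = cong₂ _+_ (Σ-zero n (λ i i<n → h i (m<n⇒m<1+n i<n))) (h n ≤-refl)

  Σ-+ : ∀ n (f g : ℕ → ℕ) → Σ< n (λ i → f i + g i) ≡ Σ< n f + Σ< n g
  Σ-+ zero    f g = refl
  Σ-+ (suc n) f g = trans (cong (_+ (f n + g n)) (Σ-+ n f g)) (interchange (Σ< n f) (Σ< n g) (f n) (g n))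
    where
    interchange : ∀ a b c d → (a + b) + (c + d) ≡ (a + c) + (b + d)
    interchange = solve-∀

  Σ-*ˡ : ∀ n c (f : ℕ → ℕ) → c * Σ< n f ≡ Σ< n (λ i → c * f i)
  Σ-*ˡ zero    c f = *-zeroʳ c
  Σ-*ˡ (suc n) c f = trans (*-distribˡ-+ c (Σ< n f) (f n)) (cong (_+ c * f n) (Σ-*ˡ n c f))

  Σ-*ʳ : ∀ n c (f : ℕ → ℕ) → Σ< n f * c ≡ Σ< n (λ i → f i * c)
  Σ-*ʳ n c f = trans (*-comm (Σ< n f) c) (trans (Σ-*ˡ n c f) (Σ-ext n (λ i → *-comm c (f i))))

  Σ-head : ∀ n (f : ℕ → ℕ) → Σ< (suc n) f ≡ f 0 + Σ< n (λ i → f (suc i))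
  Σ-head zero    f = +-comm 0 (f 0)
  Σ-head (suc n) f = trans (cong (_+ f (suc n)) (Σ-head n f)) (+-assoc (f 0) _ _)

  Σ-++ : ∀ p q (f : ℕ → ℕ) → Σ< (p + q) f ≡ Σ< p f + Σ< q (λ i → f (p + i))
  Σ-++ p zero    f rewrite +-identityʳ p = sym (+-identityʳ _)
  Σ-++ p (suc q) f rewrite +-suc p q = trans (cong (_+ f (p + q)) (Σ-++ p q f)) (+-assoc (Σ< p f) _ _)

  Σ-const : ∀ n c → Σ< n (λ _ → c) ≡ n * c
  Σ-const zero    c = refl
  Σ-const (suc n) c = trans (cong (_+ c) (Σ-const n c)) (+-comm (n * c) c)

  Σ-swap : ∀ a b (h : ℕ → ℕ → ℕ) → Σ< a (λ x → Σ< b (h x)) ≡ Σ< b (λ i → Σ< a (λ x → h x i))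
  Σ-swap zero    b h = sym (Σ-zero b (λ _ _ → refl))
  Σ-swap (suc a) b h = trans (cong (_+ Σ< b (h a)) (Σ-swap a b h)) (sym (Σ-+ b _ _))

  Σ-reverse : ∀ n (f : ℕ → ℕ) → Σ< n f ≡ Σ< n (λ i → f (n ∸ suc i))
  Σ-reverse zero    f = refl
  Σ-reverse (suc n) f = trans (+-comm (Σ< n f) (f n)) (trans (cong (f n +_) (Σ-reverse n f)) (sym (Σ-head n _)))

  Σ-single : ∀ n j (f : ℕ → ℕ) → j < n → (∀ i → i < n → i ≢ j → f i ≡ 0) → Σ< n f ≡ f j
  Σ-single (suc n) j f j<1+n h with n ≟ j
  ... | yes refl = cong (_+ f n) (Σ-zero n (λ i i<n → h i (m<n⇒m<1+n i<n) (<⇒≢ i<n)))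
  ... | no n≢j   = trans (cong₂ _+_ (Σ-single n j f j<n (λ i i<n → h i (m<n⇒m<1+n i<n))) (h n ≤-refl n≢j))
                         (+-identityʳ (f j))
    where j<n = ≤∧≢⇒< (s≤s⁻¹ j<1+n) (≢-sym n≢j)

  nCk*k!*[n∸k]!≡n! : ∀ {n k} → k ≤ n → (n C k) * (k ! * (n ∸ k) !) ≡ n !
  nCk*k!*[n∸k]!≡n! {n} {k} k≤n =
    trans (cong (_* (k ! * (n ∸ k) !)) (nCk≡n!/k![n-k]! k≤n)) (m/n*n≡m (k![n∸k]!∣n! k≤n))
    where instance _ = k !* (n ∸ k) !≢0

  conv : ℕ → (ℕ → ℕ) → (ℕ → ℕ) → ℕ
  conv n A B = Σ< (suc n) (λ i → (n C i) * (A i * B (n ∸ i)))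

  product-zeroʳ : ∀ c a {b} → b ≡ 0 → c * (a * b) ≡ 0
  product-zeroʳ c a refl = trans (cong (c *_) (*-zeroʳ a)) (*-zeroʳ c)

  conv-zeroʳ : ∀ n A → conv n A (λ _ → 0) ≡ 0
  conv-zeroʳ n A = Σ-zero (suc n) (λ i _ → product-zeroʳ (n C i) (A i) refl)

  conv-singleʳ-≤ : ∀ n A B l → l ≤ n → (∀ u → u ≢ l → B u ≡ 0) →
                   conv n A B ≡ (n C (n ∸ l)) * (A (n ∸ l) * B l)
  conv-singleʳ-≤ n A B l l≤n h = trans (Σ-single (suc n) (n ∸ l) _ (s≤s (m∸n≤m n l)) others)
    (cong (λ u → (n C (n ∸ l)) * (A (n ∸ l) * B u)) (m∸[m∸n]≡n l≤n))
    where
    others : ∀ i → i < suc n → i ≢ n ∸ l → (n C i) * (A i * B (n ∸ i)) ≡ 0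
    others i i<1+n i≢n∸l = product-zeroʳ (n C i) (A i) (h (n ∸ i) (λ e →
      i≢n∸l (trans (sym (m∸[m∸n]≡n (s≤s⁻¹ i<1+n))) (cong (n ∸_) e))))

  conv-singleʳ-> : ∀ n A B l → n < l → (∀ u → u ≢ l → B u ≡ 0) → conv n A B ≡ 0
  conv-singleʳ-> n A B l n<l h = Σ-zero (suc n) (λ i _ →
    product-zeroʳ (n C i) (A i) (h (n ∸ i) (<⇒≢ (≤-<-trans (m∸n≤m n i) n<l))))

  conv-pascal : ∀ n A B → conv (suc n) A B ≡ conv n (λ i → A (suc i)) B + conv n A (λ t → B (suc t))
  conv-pascal n A B = begin
    conv (suc n) A B
      ≡⟨ Σ-head (suc n) _ ⟩
    first + Σ< (suc n) (λ i → (suc n C suc i) * X i)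
      ≡⟨ cong (first +_) (trans (Σ-ext (suc n) pascal) (Σ-+ (suc n) _ _)) ⟩
    first + (conv n (λ i → A (suc i)) B + Σ< (suc n) (λ i → (n C suc i) * X i))
      ≡⟨ x+[y+z]≡y+[x+z] first (conv n (λ i → A (suc i)) B) _ ⟩
    conv n (λ i → A (suc i)) B + (first + Σ< (suc n) (λ i → (n C suc i) * X i))
      ≡⟨ cong (conv n (λ i → A (suc i)) B +_) shifted ⟩
    conv n (λ i → A (suc i)) B + conv n A (λ t → B (suc t)) ∎
    where
    first = (n C 0) * (A 0 * B (suc n))
    X : ℕ → ℕ
    X i = A (suc i) * B (n ∸ i)
    x+[y+z]≡y+[x+z] : ∀ x y z → x + (y + z) ≡ y + (x + z)
    x+[y+z]≡y+[x+z] = solve-∀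
    pascal : ∀ i → (suc n C suc i) * X i ≡ (n C i) * X i + (n C suc i) * X i
    pascal i = trans (cong (_* X i) (sym (nCk+nC[k+1]≡[n+1]C[k+1] n i))) (*-distribʳ-+ (X i) (n C i) (n C suc i))
    shifted : first + Σ< (suc n) (λ i → (n C suc i) * X i) ≡ conv n A (λ t → B (suc t))
    shifted = begin
      first + (Σ< n (λ i → (n C suc i) * X i) + (n C suc n) * X n)
        ≡⟨ cong (λ c → first + (Σ< n (λ i → (n C suc i) * X i) + c * X n)) (k>n⇒nCk≡0 (n<1+n n)) ⟩
      first + (Σ< n (λ i → (n C suc i) * X i) + 0)
        ≡⟨ cong (first +_) (trans (+-identityʳ _) (Σ-cong n (λ i i<n →
             cong (λ t → (n C suc i) * (A (suc i) * B t)) (+-∸-assoc 1 i<n)))) ⟩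
      first + Σ< n (λ i → (n C suc i) * (A (suc i) * B (suc (n ∸ suc i))))
        ≡⟨ Σ-head n _ ⟨
      conv n A (λ t → B (suc t)) ∎

  conv-Σˡ : ∀ n p (F : ℕ → ℕ → ℕ) B →
            Σ< p (λ i → conv n (F i) B) ≡ conv n (λ t → Σ< p (λ i → F i t)) B
  conv-Σˡ n p F B = trans (Σ-swap p (suc n) _) (Σ-ext (suc n) (λ t →
    trans (sym (Σ-*ˡ p (n C t) _)) (cong ((n C t) *_) (sym (Σ-*ʳ p (B (n ∸ t)) (λ i → F i t))))))

  conv-Σʳ : ∀ n q A (F : ℕ → ℕ → ℕ) →
            Σ< q (λ j → conv n A (F j)) ≡ conv n A (λ t → Σ< q (λ j → F j t))
  conv-Σʳ n q A F = trans (Σ-swap q (suc n) _) (Σ-ext (suc n) (λ t →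
    trans (sym (Σ-*ˡ q (n C t) _)) (cong ((n C t) *_) (sym (Σ-*ˡ q (A t) (λ j → F j (n ∸ t)))))))

  conv-zeroˡ : ∀ n B → conv n (λ _ → 0) B ≡ 0
  conv-zeroˡ n B = Σ-zero (suc n) (λ i _ → *-zeroʳ (n C i))


  -- Parking on a line

  succeeded : {A : Set} → Maybe A → ℕ
  succeeded nothing  = 0
  succeeded (just _) = 1

  occupied : List Bool → ℕ
  occupied []           = 0
  occupied (true ∷ xs)  = suc (occupied xs)
  occupied (false ∷ xs) = occupied xs

  full : List Bool → ℕ
  full []           = 1
  full (true ∷ xs)  = full xs
  full (false ∷ xs) = 0

  -- PL L * PR R if the occupancy is L ++ false ∷ R with length L = p, and 0 otherwise.
  gapAt : ℕ → (List Bool → ℕ) → (List Bool → ℕ) → List Bool → ℕ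
  gapAt p       PL PR []          = 0
  gapAt zero    PL PR (true ∷ R)  = 0
  gapAt zero    PL PR (false ∷ R) = PL [] * PR R
  gapAt (suc p) PL PR (x ∷ Y)     = gapAt p (λ L → PL (x ∷ L)) PR Y

  map≡just : {A B : Set} (f : A → B) (m : Maybe A) {y : B} →
             Maybe.map f m ≡ just y → Σ A (λ x → m ≡ just x × f x ≡ y)
  map≡just f (just x) refl = x , refl , refl

  park-length-occupied : ∀ X a {Y} → park X a ≡ just Y → length Y ≡ length X × occupied Y ≡ suc (occupied X)
  park-length-occupied (false ∷ X) (suc zero) refl = refl , refl
  park-length-occupied (true ∷ X) (suc zero) e with map≡just (true ∷_) (park X 1) e
  ... | _ , e′ , refl with park-length-occupied X 1 e′
  ...   | l , o = cong suc l , cong suc o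
  park-length-occupied (false ∷ X) (suc (suc a)) e with map≡just (false ∷_) (park X (suc a)) e
  ... | _ , e′ , refl with park-length-occupied X (suc a) e′
  ...   | l , o = cong suc l , o
  park-length-occupied (true ∷ X) (suc (suc a)) e with map≡just (true ∷_) (park X (suc a)) e
  ... | _ , e′ , refl with park-length-occupied X (suc a) e′
  ...   | l , o = cong suc l , cong suc o

  park-length : ∀ X a {Y} → park X a ≡ just Y → length Y ≡ length X
  park-length X a e = proj₁ (park-length-occupied X a e)

  park-cons : ∀ x Y a → park (x ∷ Y) (suc (suc a)) ≡ Maybe.map (x ∷_) (park Y (suc a))
  park-cons true  Y a = refl
  park-cons false Y a = refl

  bind-park-zero : ∀ m → (m >>= λ Y → park Y 0) ≡ nothing
  bind-park-zero nothing        = refl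
  bind-park-zero (just [])      = refl
  bind-park-zero (just (_ ∷ _)) = refl

  bind-park-one-free : ∀ m → (Maybe.map (false ∷_) m >>= λ Y → park Y 1) ≡ Maybe.map (true ∷_) m
  bind-park-one-free nothing  = refl
  bind-park-one-free (just _) = refl

  bind-cons : ∀ x m {b b′} → (∀ Y → park (x ∷ Y) b ≡ Maybe.map (x ∷_) (park Y b′)) →
              (Maybe.map (x ∷_) m >>= λ Y → park Y b) ≡ Maybe.map (x ∷_) (m >>= λ Y → park Y b′)
  bind-cons x nothing  h = refl
  bind-cons x (just Y) h = h Y

  bind-cons-comm : ∀ x X {a b a′ b′} →
    (∀ Y → park (x ∷ Y) a ≡ Maybe.map (x ∷_) (park Y a′)) →
    (∀ Y → park (x ∷ Y) b ≡ Maybe.map (x ∷_) (park Y b′)) →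
    (park X a′ >>= λ Y → park Y b′) ≡ (park X b′ >>= λ Y → park Y a′) →
    (park (x ∷ X) a >>= λ Y → park Y b) ≡ (park (x ∷ X) b >>= λ Y → park Y a)
  bind-cons-comm x X {a} {b} {a′} {b′} ha hb comm = begin
    (park (x ∷ X) a >>= λ Y → park Y b)                 ≡⟨ cong (_>>= λ Y → park Y b) (ha X) ⟩
    (Maybe.map (x ∷_) (park X a′) >>= λ Y → park Y b)   ≡⟨ bind-cons x (park X a′) hb ⟩
    Maybe.map (x ∷_) (park X a′ >>= λ Y → park Y b′)    ≡⟨ cong (Maybe.map (x ∷_)) comm ⟩
    Maybe.map (x ∷_) (park X b′ >>= λ Y → park Y a′)    ≡⟨ bind-cons x (park X b′) ha ⟨
    (Maybe.map (x ∷_) (park X b′) >>= λ Y → park Y a)   ≡⟨ cong (_>>= λ Y → park Y a) (hb X) ⟨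
    (park (x ∷ X) b >>= λ Y → park Y a)                 ∎

  park-comm : ∀ X a b → (park X a >>= λ Y → park Y b) ≡ (park X b >>= λ Y → park Y a)
  park-comm []          a             b             = refl
  park-comm (x ∷ X)     zero          b             = sym (bind-park-zero (park (x ∷ X) b))
  park-comm (x ∷ X)     (suc a)       zero          = bind-park-zero (park (x ∷ X) (suc a))
  park-comm (x ∷ X)     (suc zero)    (suc zero)    = refl
  park-comm (false ∷ X) (suc zero)    (suc (suc b)) = sym (bind-park-one-free (park X (suc b)))
  park-comm (false ∷ X) (suc (suc a)) (suc zero)    = bind-park-one-free (park X (suc a))
  park-comm (true ∷ X)  (suc zero)    (suc (suc b)) =
    bind-cons-comm true X {1} {suc (suc b)} (λ _ → refl) (λ _ → refl) (park-comm X 1 (suc b))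
  park-comm (true ∷ X)  (suc (suc a)) (suc zero)    =
    bind-cons-comm true X {suc (suc a)} {1} (λ _ → refl) (λ _ → refl) (park-comm X (suc a) 1)
  park-comm (x ∷ X)     (suc (suc a)) (suc (suc b)) =
    bind-cons-comm x X {suc (suc a)} {suc (suc b)} (λ Y → park-cons x Y a) (λ Y → park-cons x Y b)
      (park-comm X (suc a) (suc b))

  -- The outcome of parking in L ++ R given the outcome in L alone: a car overflowing L takes the first
  -- free space of R.
  spill : List Bool → List Bool → Maybe (List Bool) → Maybe (List Bool)
  spill L R (just L′) = just (L′ ++ R)
  spill L R nothing   = Maybe.map (L ++_) (park R 1)

  map-spill : ∀ x L R m → Maybe.map (x ∷_) (spill L R m) ≡ spill (x ∷ L) R (Maybe.map (x ∷_) m)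
  map-spill x L R nothing  = sym (map-∘ (park R 1))
  map-spill x L R (just _) = refl

  park-++ˡ : ∀ L R a → a ≤ length L → park (L ++ R) (suc a) ≡ spill L R (park L (suc a))
  park-++ˡ []          R zero    _         = sym (map-id (park R 1))
  park-++ˡ (false ∷ L) R zero    _         = refl
  park-++ˡ (true ∷ L)  R zero    _         =
    trans (cong (Maybe.map (true ∷_)) (park-++ˡ L R zero z≤n)) (map-spill true L R (park L 1))
  park-++ˡ (x ∷ L)     R (suc a) (s≤s a≤) = begin
    park (x ∷ (L ++ R)) (suc (suc a))                 ≡⟨ park-cons x (L ++ R) a ⟩
    Maybe.map (x ∷_) (park (L ++ R) (suc a))          ≡⟨ cong (Maybe.map (x ∷_)) (park-++ˡ L R a a≤) ⟩
    Maybe.map (x ∷_) (spill L R (park L (suc a)))     ≡⟨ map-spill x L R (park L (suc a)) ⟩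
    spill (x ∷ L) R (Maybe.map (x ∷_) (park L (suc a))) ≡⟨ cong (spill (x ∷ L) R) (park-cons x L a) ⟨
    spill (x ∷ L) R (park (x ∷ L) (suc (suc a)))     ∎

  park-++ʳ : ∀ L R b → park (L ++ R) (suc (length L + b)) ≡ Maybe.map (L ++_) (park R (suc b))
  park-++ʳ []      R b = sym (map-id (park R (suc b)))
  park-++ʳ (x ∷ L) R b = trans (park-cons x (L ++ R) (length L + b))
    (trans (cong (Maybe.map (x ∷_)) (park-++ʳ L R b)) (sym (map-∘ (park R (suc b)))))

  park-++-first-free : ∀ L R → park (L ++ R) (suc (length L)) ≡ Maybe.map (L ++_) (park R 1)
  park-++-first-free L R = trans (cong (λ z → park (L ++ R) (suc z)) (sym (+-identityʳ (length L)))) (park-++ʳ L R 0)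

  succeeded-map : {A B : Set} (f : A → B) (m : Maybe A) → succeeded (Maybe.map f m) ≡ succeeded m
  succeeded-map f nothing  = refl
  succeeded-map f (just _) = refl

  succeeded-park-one+full : ∀ xs → succeeded (park xs 1) + full xs ≡ 1
  succeeded-park-one+full []           = refl
  succeeded-park-one+full (false ∷ xs) = refl
  succeeded-park-one+full (true ∷ xs)  =
    trans (cong (_+ full xs) (succeeded-map (true ∷_) (park xs 1))) (succeeded-park-one+full xs)

  succeeded-park-suc : ∀ Y r → succeeded (park Y (suc r)) ≡ succeeded (park Y (suc (suc r))) + gapAt r (const 1) full Y
  succeeded-park-suc []           r       = refl
  succeeded-park-suc (false ∷ xs) zero    =
    sym (trans (cong₂ _+_ (succeeded-map (false ∷_) (park xs 1)) (+-identityʳ (full xs))) (succeeded-park-one+full xs))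
  succeeded-park-suc (true ∷ xs)  zero    = sym (+-identityʳ _)
  succeeded-park-suc (x ∷ xs)     (suc r) = begin
    succeeded (park (x ∷ xs) (suc (suc r)))                      ≡⟨ cong succeeded (park-cons x xs r) ⟩
    succeeded (Maybe.map (x ∷_) (park xs (suc r)))               ≡⟨ succeeded-map (x ∷_) (park xs (suc r)) ⟩
    succeeded (park xs (suc r))                                  ≡⟨ succeeded-park-suc xs r ⟩
    succeeded (park xs (suc (suc r))) + gapAt r (const 1) full xs ≡⟨ cong (_+ gapAt r (const 1) full xs) (sym
      (trans (cong succeeded (park-cons x xs (suc r))) (succeeded-map (x ∷_) (park xs (suc (suc r)))))) ⟩
    succeeded (park (x ∷ xs) (suc (suc (suc r)))) + gapAt r (const 1) full xs ∎

  -- Positions past the end read as occupied.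
  occupiedAt : List Bool → ℕ → Bool
  occupiedAt []       _       = true
  occupiedAt (x ∷ _)  zero    = x
  occupiedAt (_ ∷ xs) (suc i) = occupiedAt xs i

  occupiedAt-++ : ∀ L x R → occupiedAt (L ++ x ∷ R) (length L) ≡ x
  occupiedAt-++ []      x R = refl
  occupiedAt-++ (_ ∷ L) x R = occupiedAt-++ L x R

  gapAt-occupied : ∀ p PL PR Y → occupiedAt Y p ≡ true → gapAt p PL PR Y ≡ 0
  gapAt-occupied p       PL PR []          e  = refl
  gapAt-occupied zero    PL PR (true ∷ Y)  e  = refl
  gapAt-occupied zero    PL PR (false ∷ Y) ()
  gapAt-occupied (suc p) PL PR (x ∷ Y)     e  = gapAt-occupied p (λ L → PL (x ∷ L)) PR Y e

  gapAt-++ : ∀ L R PL PR → gapAt (length L) PL PR (L ++ false ∷ R) ≡ PL L * PR R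
  gapAt-++ []      R PL PR = refl
  gapAt-++ (x ∷ L) R PL PR = gapAt-++ L R (λ L′ → PL (x ∷ L′)) PR

  park-keeps-occupied : ∀ X a p {Y} → park X a ≡ just Y → occupiedAt X p ≡ true → occupiedAt Y p ≡ true
  park-keeps-occupied (false ∷ X) (suc zero) zero    refl o = refl
  park-keeps-occupied (false ∷ X) (suc zero) (suc p) refl o = o
  park-keeps-occupied (true ∷ X) (suc zero) p e o with map≡just (true ∷_) (park X 1) e
  park-keeps-occupied (true ∷ X) (suc zero) zero    e o | _ , e′ , refl = refl
  park-keeps-occupied (true ∷ X) (suc zero) (suc p) e o | _ , e′ , refl = park-keeps-occupied X 1 p e′ o
  park-keeps-occupied (x ∷ X) (suc (suc a)) p e o with map≡just (x ∷_) (park X (suc a)) (trans (sym (park-cons x X a)) e)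
  park-keeps-occupied (x ∷ X) (suc (suc a)) zero    e o | _ , e′ , refl = o
  park-keeps-occupied (x ∷ X) (suc (suc a)) (suc p) e o | _ , e′ , refl = park-keeps-occupied X (suc a) p e′ o

  -- Counting preference sequences

  Step : Set
  Step = List Bool → ℕ → Maybe (List Bool)

  -- Sum of P over the final occupancies of all runs of n cars with preferences in [1..s], started from m
  -- and parked by st; a run in which some car fails contributes 0.
  countBy : Step → ℕ → Maybe (List Bool) → ℕ → (List Bool → ℕ) → ℕ
  countBy st s nothing  n       P = 0
  countBy st s (just X) zero    P = P X
  countBy st s (just X) (suc n) P = Σ< s (λ i → countBy st s (st X (suc i)) n P)

  module _ (st : Step) (s : ℕ) where

    count-ext : ∀ m n {P Q : List Bool → ℕ} → (∀ Y → P Y ≡ Q Y) → countBy st s m n P ≡ countBy st s m n Q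
    count-ext nothing  n       h = refl
    count-ext (just X) zero    h = h X
    count-ext (just X) (suc n) h = Σ-ext s (λ i → count-ext (st X (suc i)) n h)

    count-zero : ∀ m n → countBy st s m n (const 0) ≡ 0
    count-zero nothing  n       = refl
    count-zero (just X) zero    = refl
    count-zero (just X) (suc n) = Σ-zero s (λ i _ → count-zero (st X (suc i)) n)

    count-+ : ∀ m n (P Q : List Bool → ℕ) →
              countBy st s m n (λ Y → P Y + Q Y) ≡ countBy st s m n P + countBy st s m n Q
    count-+ nothing  n       P Q = refl
    count-+ (just X) zero    P Q = refl
    count-+ (just X) (suc n) P Q = trans (Σ-ext s (λ i → count-+ (st X (suc i)) n P Q)) (Σ-+ s _ _)

    count-*ˡ : ∀ m n c (P : List Bool → ℕ) → c * countBy st s m n P ≡ countBy st s m n (λ Y → c * P Y)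
    count-*ˡ nothing  n       c P = *-zeroʳ c
    count-*ˡ (just X) zero    c P = refl
    count-*ˡ (just X) (suc n) c P = trans (Σ-*ˡ s c _) (Σ-ext s (λ i → count-*ˡ (st X (suc i)) n c P))

    count-Σ : ∀ m n k (P : ℕ → List Bool → ℕ) →
              countBy st s m n (λ Y → Σ< k (λ i → P i Y)) ≡ Σ< k (λ i → countBy st s m n (P i))
    count-Σ m n zero    P = count-zero m n
    count-Σ m n (suc k) P = trans (count-+ m n _ (P k)) (cong (_+ countBy st s m n (P k)) (count-Σ m n k P))

    count-cong-invariant : (I : ℕ → List Bool → Set) → (∀ {t X a Y} → I (suc t) X → st X a ≡ just Y → I t Y) →
      ∀ {P Q : List Bool → ℕ} → (∀ Y → I 0 Y → P Y ≡ Q Y) →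
      ∀ n X → I n X → countBy st s (just X) n P ≡ countBy st s (just X) n Q
    count-cong-invariant I pres h zero    X i = h X i
    count-cong-invariant I pres h (suc n) X i = Σ-ext s (λ a → after-step a (st X (suc a)) refl)
      where
      after-step : ∀ a m → st X (suc a) ≡ m → countBy st s m n _ ≡ countBy st s m n _
      after-step a nothing  e = refl
      after-step a (just Y) e = count-cong-invariant I pres h n Y (pres i e)

    count-vanishes-occupied : (∀ X a p {Y} → st X a ≡ just Y → occupiedAt X p ≡ true → occupiedAt Y p ≡ true) →
      ∀ p {P : List Bool → ℕ} → (∀ Y → occupiedAt Y p ≡ true → P Y ≡ 0) →
      ∀ n X → occupiedAt X p ≡ true → countBy st s (just X) n P ≡ 0
    count-vanishes-occupied keeps p h n X o =
      trans (count-cong-invariant (λ _ Y → occupiedAt Y p ≡ true) (λ o′ e → keeps _ _ p e o′) h n X o)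
            (count-zero (just X) n)

    module _ (st-fills : ∀ X a {Y} → st X a ≡ just Y → length Y ≡ length X × occupied Y ≡ suc (occupied X)) where

      count-cong-filled : ∀ {P Q : List Bool → ℕ} n X →
        (∀ Y → length Y ≡ length X → occupied Y ≡ occupied X + n → P Y ≡ Q Y) →
        countBy st s (just X) n P ≡ countBy st s (just X) n Q
      count-cong-filled {P} {Q} n X h =
        count-cong-invariant I pres (λ Y (l , o) → h Y l (trans (sym (+-identityʳ _)) o)) n X (refl , refl)
        where
        I : ℕ → List Bool → Set
        I t Y = length Y ≡ length X × occupied Y + t ≡ occupied X + n
        pres : ∀ {t X′ a Y} → I (suc t) X′ → st X′ a ≡ just Y → I t Y
        pres {t} {X′} (l , o) e with st-fills X′ _ e
        ... | l′ , o′ = trans l′ l , trans (cong (_+ t) o′) (trans (sym (+-suc (occupied X′) t)) o)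

  count : ℕ → Maybe (List Bool) → ℕ → (List Bool → ℕ) → ℕ
  count = countBy park

  count-park-last : ∀ s n X a P → count s (park X a) n P ≡ count s (just X) n (λ Y → count s (park Y a) 0 P)
  count-park-last s zero    X a P = refl
  count-park-last s (suc n) X a P = begin
    count s (park X a) (suc n) P
      ≡⟨ bind-first (park X a) ⟩
    Σ< s (λ i → count s (park X a >>= λ Y → park Y (suc i)) n P)
      ≡⟨ Σ-ext s (λ i → cong (λ m → count s m n P) (park-comm X a (suc i))) ⟩
    Σ< s (λ i → count s (park X (suc i) >>= λ Y → park Y a) n P)
      ≡⟨ Σ-ext s (λ i → bind-last (park X (suc i))) ⟩
    count s (just X) (suc n) (λ Y → count s (park Y a) 0 P) ∎
    where
    bind-first : ∀ m → count s m (suc n) P ≡ Σ< s (λ i → count s (m >>= λ Y → park Y (suc i)) n P)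
    bind-first nothing  = sym (Σ-zero s (λ _ _ → refl))
    bind-first (just X) = refl
    bind-last : ∀ m → count s (m >>= λ Y → park Y a) n P ≡ count s m n (λ Y → count s (park Y a) 0 P)
    bind-last nothing  = refl
    bind-last (just Y) = count-park-last s n Y a P

  count-gapAt-occupied : ∀ s n L R PL PR → count s (just (L ++ true ∷ R)) n (gapAt (length L) PL PR) ≡ 0
  count-gapAt-occupied s n L R PL PR = count-vanishes-occupied park s park-keeps-occupied (length L)
    (λ Y o → gapAt-occupied (length L) PL PR Y o) n (L ++ true ∷ R) (occupiedAt-++ L true R)

  -- While space p stays free, a car preferring a space ≤ p parks to its left and any other car to its
  -- right, so the runs are shuffles of a run on L and a run on R.
  count-gapAt : ∀ n p q L R PL PR → length L ≡ p → length R ≡ q →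
    count (p + suc q) (just (L ++ false ∷ R)) n (gapAt p PL PR)
      ≡ conv n (λ i → count p (just L) i PL) (λ t → count q (just R) t PR)
  count-gapAt zero    _ _ L R PL PR refl refl = trans (gapAt-++ L R PL PR) (sym (+-identityʳ _))
  count-gapAt (suc n) _ _ L R PL PR refl refl = begin
    Σ< (p + suc q) (λ i → count s (park (L ++ false ∷ R) (suc i)) n G)
      ≡⟨ Σ-++ p (suc q) _ ⟩
    Σ< p (λ i → count s (park (L ++ false ∷ R) (suc i)) n G)
      + Σ< (suc q) (λ j → count s (park (L ++ false ∷ R) (suc (p + j))) n G)
      ≡⟨ cong₂ _+_ (Σ-cong p left) (Σ-head q _) ⟩
    Σ< p (λ i → conv n (λ t → count p (park L (suc i)) t PL) B)
      + (count s (park (L ++ false ∷ R) (suc (p + 0))) n G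
         + Σ< q (λ j → count s (park (L ++ false ∷ R) (suc (p + suc j))) n G))
      ≡⟨ cong₂ _+_ (conv-Σˡ n p _ B) (cong₂ _+_ gap (Σ-ext q right)) ⟩
    conv n (λ t → A (suc t)) B + (0 + Σ< q (λ j → conv n A (λ t → count q (park R (suc j)) t PR)))
      ≡⟨ cong (conv n (λ t → A (suc t)) B +_) (conv-Σʳ n q A (λ j t → count q (park R (suc j)) t PR)) ⟩
    conv n (λ t → A (suc t)) B + conv n A (λ t → B (suc t))
      ≡⟨ conv-pascal n A B ⟨
    conv (suc n) A B ∎
    where
    p = length L
    q = length R
    s = p + suc q
    G = gapAt p PL PR
    A : ℕ → ℕ
    A i = count p (just L) i PL
    B : ℕ → ℕ
    B t = count q (just R) t PR
    parked-left : ∀ m → (∀ L′ → m ≡ just L′ → length L′ ≡ p) →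
      count s (spill L (false ∷ R) m) n G ≡ conv n (λ t → count p m t PL) B
    parked-left nothing   h = trans (count-gapAt-occupied s n L R PL PR) (sym (conv-zeroˡ n B))
    parked-left (just L′) h = count-gapAt n p q L′ R PL PR (h L′ refl) refl
    left : ∀ i → i < p → count s (park (L ++ false ∷ R) (suc i)) n G ≡ conv n (λ t → count p (park L (suc i)) t PL) B
    left i i<p = trans (cong (λ m → count s m n G) (park-++ˡ L (false ∷ R) i (<⇒≤ i<p)))
                       (parked-left (park L (suc i)) (λ L′ e → park-length L (suc i) e))
    gap : count s (park (L ++ false ∷ R) (suc (p + 0))) n G ≡ 0
    gap = trans (cong (λ m → count s m n G) (park-++ʳ L (false ∷ R) 0)) (count-gapAt-occupied s n L R PL PR)
    parked-right : ∀ m → (∀ R′ → m ≡ just R′ → length R′ ≡ q) →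
      count s (Maybe.map (L ++_) (Maybe.map (false ∷_) m)) n G ≡ conv n A (λ t → count q m t PR)
    parked-right nothing   h = sym (conv-zeroʳ n A)
    parked-right (just R′) h = count-gapAt n p q L R′ PL PR refl (h R′ refl)
    right : ∀ j → count s (park (L ++ false ∷ R) (suc (p + suc j))) n G
                    ≡ conv n A (λ t → count q (park R (suc j)) t PR)
    right j = trans (cong (λ m → count s m n G) (park-++ʳ L (false ∷ R) (suc j)))
                    (parked-right (park R (suc j)) (λ R′ e → park-length R (suc j) e))

  -- Parking functions

  empty : ℕ → List Bool
  empty m = replicate m false

  occupied-empty : ∀ m → occupied (empty m) ≡ 0
  occupied-empty zero    = refl
  occupied-empty (suc m) = occupied-empty m

  length-empty : ∀ m → length (empty m) ≡ m
  length-empty m = length-replicate m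

  empty-++ : ∀ t l → empty (t + suc l) ≡ empty t ++ false ∷ empty l
  empty-++ zero    l = refl
  empty-++ (suc t) l = cong (false ∷_) (empty-++ t l)

  occupied≤length : ∀ Y → occupied Y ≤ length Y
  occupied≤length []          = z≤n
  occupied≤length (true ∷ Y)  = s≤s (occupied≤length Y)
  occupied≤length (false ∷ Y) = m≤n⇒m≤1+n (occupied≤length Y)

  full-filled : ∀ Y → occupied Y ≡ length Y → full Y ≡ 1
  full-filled []          e = refl
  full-filled (true ∷ Y)  e = full-filled Y (suc-injective e)
  full-filled (false ∷ Y) e = contradiction e (<⇒≢ (s≤s (occupied≤length Y)))

  full-unfilled : ∀ Y → occupied Y ≢ length Y → full Y ≡ 0
  full-unfilled []          ne = contradiction refl ne
  full-unfilled (true ∷ Y)  ne = full-unfilled Y (λ e → ne (cong suc e))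
  full-unfilled (false ∷ Y) ne = refl

  park-one-unfilled : ∀ Y → occupied Y ≢ length Y → succeeded (park Y 1) ≡ 1
  park-one-unfilled Y ne = trans (sym (+-identityʳ _))
    (trans (cong (succeeded (park Y 1) +_) (sym (full-unfilled Y ne))) (succeeded-park-one+full Y))

  park-beyond : ∀ Y a → length Y < a → succeeded (park Y a) ≡ 0
  park-beyond []      a             _         = refl
  park-beyond (x ∷ Y) (suc (suc a)) (s≤s l<a) =
    trans (cong succeeded (park-cons x Y a)) (trans (succeeded-map (x ∷_) (park Y (suc a))) (park-beyond Y (suc a) l<a))

  count-cong-empty : ∀ m n {P Q : List Bool → ℕ} → (∀ Y → length Y ≡ m → occupied Y ≡ n → P Y ≡ Q Y) →
    count m (just (empty m)) n P ≡ count m (just (empty m)) n Q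
  count-cong-empty m n h = count-cong-filled park m park-length-occupied n (empty m) (λ Y l o →
    h Y (trans l (length-empty m)) (trans o (cong (_+ n) (occupied-empty m))))

  -- pf m j counts the parking sequences of j cars on m spaces; pfFirst m r j those of j + 1 cars whose
  -- first car prefers r (the paper's p^r_{j+1,m;≤m}, see pPF≡pfFirst); pfGap m r j those of j cars after
  -- which space r, counted from 0, is free and all later spaces are full.
  pf : ℕ → ℕ → ℕ
  pf m j = count m (just (empty m)) j (const 1)

  pfFirst : ℕ → ℕ → ℕ → ℕ
  pfFirst m r j = count m (park (empty m) r) j (const 1)

  pfGap : ℕ → ℕ → ℕ → ℕ
  pfGap m r j = count m (just (empty m)) j (gapAt r (const 1) full)

  pfFirst-count : ∀ m a j → pfFirst m a j ≡ count m (just (empty m)) j (λ Y → succeeded (park Y a))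
  pfFirst-count m a j = trans (count-park-last m j (empty m) a (const 1))
    (count-ext park m (just (empty m)) j (λ Y → count-succeeded (park Y a)))
    where
    count-succeeded : ∀ mY → count m mY 0 (const 1) ≡ succeeded mY
    count-succeeded nothing  = refl
    count-succeeded (just _) = refl

  pfFirst-suc : ∀ m r j → pfFirst m (suc r) j ≡ pfFirst m (suc (suc r)) j + pfGap m r j
  pfFirst-suc m r j = begin
    pfFirst m (suc r) j
      ≡⟨ pfFirst-count m (suc r) j ⟩
    count m (just (empty m)) j (λ Y → succeeded (park Y (suc r)))
      ≡⟨ count-ext park m (just (empty m)) j (λ Y → succeeded-park-suc Y r) ⟩
    count m (just (empty m)) j (λ Y → succeeded (park Y (suc (suc r))) + gapAt r (const 1) full Y)
      ≡⟨ count-+ park m (just (empty m)) j _ _ ⟩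
    count m (just (empty m)) j (λ Y → succeeded (park Y (suc (suc r)))) + pfGap m r j
      ≡⟨ cong (_+ pfGap m r j) (pfFirst-count m (suc (suc r)) j) ⟨
    pfFirst m (suc (suc r)) j + pfGap m r j ∎

  pfFirst-beyond : ∀ m j → pfFirst m (suc m) j ≡ 0
  pfFirst-beyond m j = begin
    pfFirst m (suc m) j
      ≡⟨ pfFirst-count m (suc m) j ⟩
    count m (just (empty m)) j (λ Y → succeeded (park Y (suc m)))
      ≡⟨ count-cong-empty m j (λ Y l _ → park-beyond Y (suc m) (≤-reflexive (cong suc l))) ⟩
    count m (just (empty m)) j (const 0)
      ≡⟨ count-zero park m (just (empty m)) j ⟩
    0 ∎

  pfFirst-one : ∀ m j → j < m → pfFirst m 1 j ≡ pf m j
  pfFirst-one m j j<m = trans (pfFirst-count m 1 j)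
    (count-cong-empty m j (λ Y l o → park-one-unfilled Y (λ e → <⇒≢ j<m (trans (sym o) (trans e l)))))

  pfFirst-telescope : ∀ m j d r → r + d ≡ m → pfFirst m (suc r) j ≡ Σ< d (λ t → pfGap m (r + t) j)
  pfFirst-telescope m j zero    r e =
    trans (cong (λ z → pfFirst m (suc z) j) (trans (sym (+-identityʳ r)) e)) (pfFirst-beyond m j)
  pfFirst-telescope m j (suc d) r e = begin
    pfFirst m (suc r) j
      ≡⟨ pfFirst-suc m r j ⟩
    pfFirst m (suc (suc r)) j + pfGap m r j
      ≡⟨ cong (_+ pfGap m r j) (pfFirst-telescope m j d (suc r) (trans (sym (+-suc r d)) e)) ⟩
    Σ< d (λ t → pfGap m (suc r + t) j) + pfGap m r j
      ≡⟨ +-comm _ (pfGap m r j) ⟩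
    pfGap m r j + Σ< d (λ t → pfGap m (suc r + t) j)
      ≡⟨ cong₂ _+_ (cong (λ z → pfGap m z j) (sym (+-identityʳ r)))
                   (Σ-ext d (λ t → cong (λ z → pfGap m z j) (sym (+-suc r t)))) ⟩
    pfGap m (r + 0) j + Σ< d (λ t → pfGap m (r + suc t) j)
      ≡⟨ Σ-head d _ ⟨
    Σ< (suc d) (λ t → pfGap m (r + t) j) ∎

  count-full-filled : ∀ l → count l (just (empty l)) l full ≡ pf l l
  count-full-filled l = count-cong-empty l l (λ Y len o → full-filled Y (trans o (sym len)))

  count-full-unfilled : ∀ l u → u ≢ l → count l (just (empty l)) u full ≡ 0
  count-full-unfilled l u u≢l = trans
    (count-cong-empty l u (λ Y len o → full-unfilled Y (λ e → u≢l (trans (sym o) (trans e len)))))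
    (count-zero park l (just (empty l)) u)

  pfGap-conv : ∀ t l j → pfGap (t + suc l) t j ≡ conv j (pf t) (λ u → count l (just (empty l)) u full)
  pfGap-conv t l j = trans (cong (λ X → count (t + suc l) (just X) j (gapAt t (const 1) full)) (empty-++ t l))
    (count-gapAt j t l (empty t) (empty l) (const 1) full (length-empty t) (length-empty l))

  pfGap-≤ : ∀ {m} t l j → m ≡ t + suc l → l ≤ j → pfGap m t j ≡ (j C (j ∸ l)) * (pf t (j ∸ l) * pf l l)
  pfGap-≤ t l j refl l≤j = begin
    pfGap (t + suc l) t j
      ≡⟨ pfGap-conv t l j ⟩
    conv j (pf t) (λ u → count l (just (empty l)) u full)
      ≡⟨ conv-singleʳ-≤ j (pf t) _ l l≤j (count-full-unfilled l) ⟩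
    (j C (j ∸ l)) * (pf t (j ∸ l) * count l (just (empty l)) l full)
      ≡⟨ cong (λ z → (j C (j ∸ l)) * (pf t (j ∸ l) * z)) (count-full-filled l) ⟩
    (j C (j ∸ l)) * (pf t (j ∸ l) * pf l l) ∎

  pfGap-> : ∀ {m} t l j → m ≡ t + suc l → j < l → pfGap m t j ≡ 0
  pfGap-> t l j refl j<l = trans (pfGap-conv t l j) (conv-singleʳ-> j (pf t) _ l j<l (count-full-unfilled l))

  1+[j+k]≡[j∸l+k]+1+l : ∀ j k l → l ≤ j → suc (j + k) ≡ (j ∸ l + k) + suc l
  1+[j+k]≡[j∸l+k]+1+l j k l l≤j = trans (cong (λ z → suc (z + k)) (sym (m∸n+n≡m l≤j))) (rearrange (j ∸ l) l k)
    where
    rearrange : ∀ a l k → suc (a + l + k) ≡ (a + k) + suc l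
    rearrange = solve-∀

  pfFirst-step : ∀ j k l → l ≤ j →
    pfFirst (suc (j + k)) (suc (j ∸ l + k)) j
      ≡ pfFirst (suc (j + k)) (suc (suc (j ∸ l + k))) j + (j C (j ∸ l)) * (pf (j ∸ l + k) (j ∸ l) * pf l l)
  pfFirst-step j k l l≤j = trans (pfFirst-suc (suc (j + k)) (j ∸ l + k) j)
    (cong (pfFirst (suc (j + k)) (suc (suc (j ∸ l + k))) j +_)
          (pfGap-≤ (j ∸ l + k) l j (1+[j+k]≡[j∸l+k]+1+l j k l l≤j) l≤j))

  pfFirst-last : ∀ j k → pfFirst (suc (j + k)) (suc (j + k)) j ≡ pf (j + k) j
  pfFirst-last j k = begin
    pfFirst (suc (j + k)) (suc (j + k)) j
      ≡⟨ pfFirst-step j k 0 z≤n ⟩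
    pfFirst (suc (j + k)) (suc (suc (j + k))) j + (j C j) * (pf (j + k) j * 1)
      ≡⟨ cong₂ (λ a c → a + c * (pf (j + k) j * 1)) (pfFirst-beyond (suc (j + k)) j) (nCn≡1 j) ⟩
    1 * (pf (j + k) j * 1)
      ≡⟨ trans (*-identityˡ _) (*-identityʳ _) ⟩
    pf (j + k) j ∎

  -- Classify the sequences by their last free space.
  pf-decompose : ∀ j k → pf (suc (j + k)) j ≡ Σ< (suc j) (λ l → (j C (j ∸ l)) * (pf (j ∸ l + k) (j ∸ l) * pf l l))
  pf-decompose j k = begin
    pf m j
      ≡⟨ pfFirst-one m j (s≤s (m≤m+n j k)) ⟨
    pfFirst m 1 j
      ≡⟨ pfFirst-telescope m j m 0 refl ⟩
    Σ< m (λ t → pfGap m t j)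
      ≡⟨ Σ-reverse m _ ⟩
    Σ< (suc j + k) (λ l → pfGap m (m ∸ suc l) j)
      ≡⟨ Σ-++ (suc j) k _ ⟩
    Σ< (suc j) (λ l → pfGap m (m ∸ suc l) j) + Σ< k (λ i → pfGap m (m ∸ suc (suc j + i)) j)
      ≡⟨ cong₂ _+_ (Σ-cong (suc j) gap-left) (Σ-zero k gap-right) ⟩
    Σ< (suc j) (λ l → (j C (j ∸ l)) * (pf (j ∸ l + k) (j ∸ l) * pf l l)) + 0
      ≡⟨ +-identityʳ _ ⟩
    Σ< (suc j) (λ l → (j C (j ∸ l)) * (pf (j ∸ l + k) (j ∸ l) * pf l l)) ∎
    where
    m = suc (j + k)
    gap-left : ∀ l → l < suc j → pfGap m (m ∸ suc l) j ≡ (j C (j ∸ l)) * (pf (j ∸ l + k) (j ∸ l) * pf l l)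
    gap-left l l<1+j = trans (cong (λ t → pfGap m t j) (+-∸-comm k (s≤s⁻¹ l<1+j)))
      (pfGap-≤ (j ∸ l + k) l j (1+[j+k]≡[j∸l+k]+1+l j k l (s≤s⁻¹ l<1+j)) (s≤s⁻¹ l<1+j))
    gap-right : ∀ i → i < k → pfGap m (m ∸ suc (suc j + i)) j ≡ 0
    gap-right i i<k = pfGap-> (m ∸ suc (suc j + i)) (suc j + i) j (sym (m∸n+n≡m inside)) (s≤s (m≤m+n j i))
      where
      inside : suc (suc j + i) ≤ m
      inside = s≤s (≤-trans (≤-reflexive (sym (+-suc j i))) (+-monoʳ-≤ j i<k))

  pfFirst-flat : ∀ j k → pfFirst (suc (j + k)) 1 j ≡ pfFirst (suc (j + k)) (suc k) j
  pfFirst-flat j k = from 0 k refl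
    where
    m = suc (j + k)
    from : ∀ r d → r + d ≡ k → pfFirst m (suc r) j ≡ pfFirst m (suc k) j
    from r zero    e = cong (λ z → pfFirst m (suc z) j) (trans (sym (+-identityʳ r)) e)
    from r (suc d) e = begin
      pfFirst m (suc r) j
        ≡⟨ pfFirst-suc m r j ⟩
      pfFirst m (suc (suc r)) j + pfGap m r j
        ≡⟨ cong (pfFirst m (suc (suc r)) j +_) (pfGap-> r (j + suc d) j m≡r+1+[j+1+d] (m<m+n j z<s)) ⟩
      pfFirst m (suc (suc r)) j + 0
        ≡⟨ +-identityʳ _ ⟩
      pfFirst m (suc (suc r)) j
        ≡⟨ from (suc r) d (trans (sym (+-suc r d)) e) ⟩
      pfFirst m (suc k) j ∎
      where
      m≡r+1+[j+1+d] : m ≡ r + suc (j + suc d)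
      m≡r+1+[j+1+d] = trans (cong (λ z → suc (j + z)) (sym e)) (rearrange j r d)
        where
        rearrange : ∀ j r d → suc (j + (r + suc d)) ≡ r + suc (j + suc d)
        rearrange = solve-∀

  -- Cayley's formula by circular parking

  empty-snoc : ∀ l → empty (suc l) ≡ empty l ++ false ∷ []
  empty-snoc zero    = refl
  empty-snoc (suc l) = cong (false ∷_) (empty-snoc l)

  parkCyclic : Step
  parkCyclic X a = park X a <∣> park X 1

  countCyclic : ℕ → Maybe (List Bool) → ℕ → (List Bool → ℕ) → ℕ
  countCyclic = countBy parkCyclic

  <∣>-just : {A : Set} (m₁ m₂ : Maybe A) {y : A} → (m₁ <∣> m₂) ≡ just y → m₁ ≡ just y ⊎ m₂ ≡ just y
  <∣>-just (just _) m₂ e = inj₁ e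
  <∣>-just nothing  m₂ e = inj₂ e

  parkCyclic-length-occupied : ∀ X a {Y} → parkCyclic X a ≡ just Y →
                               length Y ≡ length X × occupied Y ≡ suc (occupied X)
  parkCyclic-length-occupied X a e with <∣>-just (park X a) (park X 1) e
  ... | inj₁ e′ = park-length-occupied X a e′
  ... | inj₂ e′ = park-length-occupied X 1 e′

  parkCyclic-keeps-occupied : ∀ X a p {Y} → parkCyclic X a ≡ just Y → occupiedAt X p ≡ true → occupiedAt Y p ≡ true
  parkCyclic-keeps-occupied X a p e with <∣>-just (park X a) (park X 1) e
  ... | inj₁ e′ = park-keeps-occupied X a p e′
  ... | inj₂ e′ = park-keeps-occupied X 1 p e′

  just-of-succeeded : {A : Set} (m : Maybe A) → succeeded m ≡ 1 → Σ A (λ y → m ≡ just y)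
  just-of-succeeded (just y) _ = y , refl

  parkCyclic-unfilled : ∀ X a → occupied X < length X → Σ (List Bool) (λ Y → parkCyclic X a ≡ just Y)
  parkCyclic-unfilled X a o<l with park X a
  ... | just Y  = Y , refl
  ... | nothing = just-of-succeeded (park X 1) (park-one-unfilled X (<⇒≢ o<l))

  countCyclic-all : ∀ N t X → length X ≡ N → occupied X + t ≤ N → countCyclic N (just X) t (const 1) ≡ N ^ t
  countCyclic-all N zero    X l h = refl
  countCyclic-all N (suc t) X l h = trans (Σ-cong N next) (Σ-const N (N ^ t))
    where
    room : occupied X < length X
    room = subst (occupied X <_) (sym l)
      (≤-trans (s≤s (m≤m+n (occupied X) t)) (≤-trans (≤-reflexive (sym (+-suc (occupied X) t))) h))
    next : ∀ i → i < N → countCyclic N (parkCyclic X (suc i)) t (const 1) ≡ N ^ t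
    next i _ with parkCyclic-unfilled X (suc i) room
    ... | Y , e rewrite e with parkCyclic-length-occupied X (suc i) e
    ...   | lY , oY = countCyclic-all N t Y (trans lY l)
                        (subst (_≤ N) (trans (+-suc (occupied X) t) (cong (_+ t) (sym oY))) h)

  vacant : ℕ → List Bool → ℕ
  vacant i Y = if occupiedAt Y i then 0 else 1

  Σ-vacant+occupied : ∀ Y → Σ< (length Y) (λ i → vacant i Y) + occupied Y ≡ length Y
  Σ-vacant+occupied []          = refl
  Σ-vacant+occupied (true ∷ Y)  = trans (cong (_+ suc (occupied Y)) (Σ-head (length Y) (λ i → vacant i (true ∷ Y))))
                                        (trans (+-suc _ (occupied Y)) (cong suc (Σ-vacant+occupied Y)))
  Σ-vacant+occupied (false ∷ Y) = trans (cong (_+ occupied Y) (Σ-head (length Y) (λ i → vacant i (false ∷ Y))))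
                                        (cong suc (Σ-vacant+occupied Y))

  Σ-countCyclic-vacant : ∀ N t → t ≤ N →
                         Σ< N (λ i → countCyclic N (just (empty N)) t (vacant i)) ≡ (N ∸ t) * N ^ t
  Σ-countCyclic-vacant N t t≤N = begin
    Σ< N (λ i → countCyclic N (just (empty N)) t (vacant i))
      ≡⟨ count-Σ parkCyclic N (just (empty N)) t N vacant ⟨
    countCyclic N (just (empty N)) t (λ Y → Σ< N (λ i → vacant i Y))
      ≡⟨ count-cong-filled parkCyclic N parkCyclic-length-occupied t (empty N) vacancies ⟩
    countCyclic N (just (empty N)) t (λ Y → (N ∸ t) * 1)
      ≡⟨ count-*ˡ parkCyclic N (just (empty N)) t (N ∸ t) (const 1) ⟨
    (N ∸ t) * countCyclic N (just (empty N)) t (const 1)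
      ≡⟨ cong ((N ∸ t) *_) (countCyclic-all N t (empty N) (length-empty N)
                                            (subst (λ o → o + t ≤ N) (sym (occupied-empty N)) t≤N)) ⟩
    (N ∸ t) * N ^ t ∎
    where
    vacancies : ∀ Y → length Y ≡ length (empty N) → occupied Y ≡ occupied (empty N) + t →
                Σ< N (λ i → vacant i Y) ≡ (N ∸ t) * 1
    vacancies Y l o = begin
      Σ< N (λ i → vacant i Y)                                ≡⟨ m+n∸n≡m _ (occupied Y) ⟨
      Σ< N (λ i → vacant i Y) + occupied Y ∸ occupied Y       ≡⟨ cong₂ _∸_ total (trans o (cong (_+ t) (occupied-empty N))) ⟩
      N ∸ t                                                   ≡⟨ *-identityʳ (N ∸ t) ⟨
      (N ∸ t) * 1                                             ∎
      where
      lY : length Y ≡ N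
      lY = trans l (length-empty N)
      total : Σ< N (λ i → vacant i Y) + occupied Y ≡ N
      total = subst (λ n → Σ< n (λ i → vacant i Y) + occupied Y ≡ n) lY (Σ-vacant+occupied Y)

  countCyclic-vacant-occupied : ∀ s t L R → countCyclic s (just (L ++ true ∷ R)) t (vacant (length L)) ≡ 0
  countCyclic-vacant-occupied s t L R = count-vanishes-occupied parkCyclic s parkCyclic-keeps-occupied (length L)
    (λ Y o → cong (λ b → if b then 0 else 1) o) t (L ++ true ∷ R) (occupiedAt-++ L true R)

  countCyclic-vacant-last : ∀ t p L → length L ≡ p →
    countCyclic (suc p) (just (L ++ false ∷ [])) t (vacant p) ≡ count p (just L) t (const 1)
  countCyclic-vacant-last zero    _ L refl = cong (λ b → if b then 0 else 1) (occupiedAt-++ L false [])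
  countCyclic-vacant-last (suc t) _ L refl = trans (cong₂ _+_ (Σ-cong p left) last-vacant) (+-identityʳ _)
    where
    p = length L
    spill-first : ∀ m z → (spill L (false ∷ []) m <∣> z) ≡ spill L (false ∷ []) m
    spill-first nothing  z = refl
    spill-first (just _) z = refl
    parked-left : ∀ m → (∀ L′ → m ≡ just L′ → length L′ ≡ p) →
      countCyclic (suc p) (spill L (false ∷ []) m) t (vacant p) ≡ count p m t (const 1)
    parked-left nothing   h = countCyclic-vacant-occupied (suc p) t L []
    parked-left (just L′) h = countCyclic-vacant-last t p L′ (h L′ refl)
    left : ∀ i → i < p → countCyclic (suc p) (parkCyclic (L ++ false ∷ []) (suc i)) t (vacant p)
                           ≡ count p (park L (suc i)) t (const 1)
    left i i<p = begin
      countCyclic (suc p) (park (L ++ false ∷ []) (suc i) <∣> park (L ++ false ∷ []) 1) t (vacant p)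
        ≡⟨ cong (λ m → countCyclic (suc p) (m <∣> park (L ++ false ∷ []) 1) t (vacant p))
                (park-++ˡ L (false ∷ []) i (<⇒≤ i<p)) ⟩
      countCyclic (suc p) (spill L (false ∷ []) (park L (suc i)) <∣> park (L ++ false ∷ []) 1) t (vacant p)
        ≡⟨ cong (λ m → countCyclic (suc p) m t (vacant p)) (spill-first (park L (suc i)) _) ⟩
      countCyclic (suc p) (spill L (false ∷ []) (park L (suc i))) t (vacant p)
        ≡⟨ parked-left (park L (suc i)) (λ L′ e → park-length L (suc i) e) ⟩
      count p (park L (suc i)) t (const 1) ∎
    last-vacant : countCyclic (suc p) (parkCyclic (L ++ false ∷ []) (suc p)) t (vacant p) ≡ 0
    last-vacant = trans
      (cong (λ m → countCyclic (suc p) (m <∣> park (L ++ false ∷ []) 1) t (vacant p)) (park-++-first-free L (false ∷ [])))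
      (countCyclic-vacant-occupied (suc p) t L [])

  rotate : List Bool → List Bool
  rotate []       = []
  rotate (x ∷ xs) = xs ++ x ∷ []

  park-one-++-true : ∀ xs → park (xs ++ true ∷ []) 1 ≡ Maybe.map (_++ true ∷ []) (park xs 1)
  park-one-++-true []           = refl
  park-one-++-true (false ∷ xs) = refl
  park-one-++-true (true ∷ xs)  = trans (cong (Maybe.map (true ∷_)) (park-one-++-true xs))
    (trans (sym (map-∘ (park xs 1))) (map-∘ (park xs 1)))

  parkCyclic-rotate-< : ∀ x xs i → i < length xs →
    parkCyclic (xs ++ x ∷ []) (suc i) ≡ Maybe.map rotate (parkCyclic (x ∷ xs) (suc (suc i)))
  parkCyclic-rotate-< x xs i i<n rewrite park-++ˡ xs (x ∷ []) i (<⇒≤ i<n) | park-cons x xs i = rotated x (park xs (suc i))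
    where
    rotated : ∀ x m → (spill xs (x ∷ []) m <∣> park (xs ++ x ∷ []) 1)
                        ≡ Maybe.map rotate (Maybe.map (x ∷_) m <∣> park (x ∷ xs) 1)
    rotated x     (just _) = refl
    rotated false nothing  = refl
    rotated true  nothing  = trans (park-one-++-true xs) (map-∘ (park xs 1))

  parkCyclic-rotate-last : ∀ x xs →
    parkCyclic (xs ++ x ∷ []) (suc (length xs)) ≡ Maybe.map rotate (parkCyclic (x ∷ xs) 1)
  parkCyclic-rotate-last x xs rewrite park-++-first-free xs (x ∷ []) = rotated x
    where
    rotated : ∀ x → (Maybe.map (xs ++_) (park (x ∷ []) 1) <∣> park (xs ++ x ∷ []) 1)
                      ≡ Maybe.map rotate (parkCyclic (x ∷ xs) 1)
    rotated false = refl
    rotated true  = trans (park-one-++-true xs) (trans (map-∘ (park xs 1))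
      (cong (Maybe.map rotate) (sym (<∣>-idem (Maybe.map (true ∷_) (park xs 1))))))

  Σ-parkCyclic-rotate : ∀ x xs (f : Maybe (List Bool) → ℕ) →
    Σ< (suc (length xs)) (λ i → f (parkCyclic (xs ++ x ∷ []) (suc i)))
      ≡ Σ< (suc (length xs)) (λ i → f (Maybe.map rotate (parkCyclic (x ∷ xs) (suc i))))
  Σ-parkCyclic-rotate x xs f = begin
    Σ< q (λ i → f (parkCyclic (xs ++ x ∷ []) (suc i))) + f (parkCyclic (xs ++ x ∷ []) (suc q))
      ≡⟨ cong₂ _+_ (Σ-cong q (λ i i<q → cong f (parkCyclic-rotate-< x xs i i<q)))
                   (cong f (parkCyclic-rotate-last x xs)) ⟩
    Σ< q (λ i → f (Maybe.map rotate (parkCyclic (x ∷ xs) (suc (suc i))))) + f (Maybe.map rotate (parkCyclic (x ∷ xs) 1))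
      ≡⟨ +-comm (Σ< q (λ i → f (Maybe.map rotate (parkCyclic (x ∷ xs) (suc (suc i)))))) _ ⟩
    f (Maybe.map rotate (parkCyclic (x ∷ xs) 1)) + Σ< q (λ i → f (Maybe.map rotate (parkCyclic (x ∷ xs) (suc (suc i)))))
      ≡⟨ Σ-head q _ ⟨
    Σ< (suc q) (λ i → f (Maybe.map rotate (parkCyclic (x ∷ xs) (suc i)))) ∎
    where q = length xs

  countCyclic-rotate : ∀ t q m (P : List Bool → ℕ) → (∀ X → m ≡ just X → length X ≡ suc q) →
    countCyclic (suc q) (Maybe.map rotate m) t P ≡ countCyclic (suc q) m t (λ Y → P (rotate Y))
  countCyclic-rotate t       q nothing         P h = refl
  countCyclic-rotate t       q (just [])       P h with () ← h [] refl
  countCyclic-rotate zero    q (just (x ∷ xs)) P h = refl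
  countCyclic-rotate (suc t) q (just (x ∷ xs)) P h with refl ← h (x ∷ xs) refl =
    trans (Σ-parkCyclic-rotate x xs (λ m → countCyclic (suc q) m t P))
          (Σ-ext (suc q) (λ i → countCyclic-rotate t q (parkCyclic (x ∷ xs) (suc i)) P
                                  (λ Y e → proj₁ (parkCyclic-length-occupied (x ∷ xs) (suc i) e))))

  occupiedAt-++ˡ : ∀ xs ys i → i < length xs → occupiedAt (xs ++ ys) i ≡ occupiedAt xs i
  occupiedAt-++ˡ (x ∷ xs) ys zero    _         = refl
  occupiedAt-++ˡ (x ∷ xs) ys (suc i) (s≤s i<n) = occupiedAt-++ˡ xs ys i i<n

  vacant-rotate : ∀ i Y → suc i < length Y → vacant i (rotate Y) ≡ vacant (suc i) Y
  vacant-rotate i (y ∷ ys) (s≤s i<n) = cong (λ b → if b then 0 else 1) (occupiedAt-++ˡ ys (y ∷ []) i i<n)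

  rotate-empty : ∀ q → rotate (empty (suc q)) ≡ empty (suc q)
  rotate-empty zero    = refl
  rotate-empty (suc q) = cong (false ∷_) (rotate-empty q)

  countCyclic-vacant-uniform : ∀ q t i → i < suc q →
    countCyclic (suc q) (just (empty (suc q))) t (vacant i) ≡ countCyclic (suc q) (just (empty (suc q))) t (vacant 0)
  countCyclic-vacant-uniform q t zero    _        = refl
  countCyclic-vacant-uniform q t (suc i) i+1≤q = begin
    countCyclic N (just (empty N)) t (vacant (suc i))
      ≡⟨ count-cong-filled parkCyclic N parkCyclic-length-occupied t (empty N)
           (λ Y l _ → sym (vacant-rotate i Y (subst (suc (suc i) ≤_) (sym (trans l (length-empty N))) i+1≤q))) ⟩
    countCyclic N (just (empty N)) t (λ Y → vacant i (rotate Y))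
      ≡⟨ countCyclic-rotate t q (just (empty N)) (vacant i)
           (λ X e → trans (cong length (sym (just-injective e))) (length-empty N)) ⟨
    countCyclic N (just (rotate (empty N))) t (vacant i)
      ≡⟨ cong (λ X → countCyclic N (just X) t (vacant i)) (rotate-empty q) ⟩
    countCyclic N (just (empty N)) t (vacant i)
      ≡⟨ countCyclic-vacant-uniform q t i (m<n⇒m<1+n (s≤s⁻¹ i+1≤q)) ⟩
    countCyclic N (just (empty N)) t (vacant 0) ∎
    where
    N = suc q

  -- On l + 1 circular spaces all (l+1)^l sequences of l cars park and leave one space free; by rotation
  -- every space is left free equally often, and leaving the last one free means parking on the first l.
  pf-cayley : ∀ l → pf l l ≡ pL l
  pf-cayley zero       = refl
  pf-cayley (suc l-1)  = *-cancelˡ-≡ (pf l l) (N ^ l-1) N (begin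
    N * pf l l                                               ≡⟨ cong (N *_) vacant-first ⟨
    N * c₀                                                   ≡⟨ Σ-const N c₀ ⟨
    Σ< N (λ _ → c₀)                                          ≡⟨ Σ-cong N (countCyclic-vacant-uniform l l) ⟨
    Σ< N (λ i → countCyclic N (just (empty N)) l (vacant i)) ≡⟨ Σ-countCyclic-vacant N l (n≤1+n l) ⟩
    (N ∸ l) * N ^ l                                          ≡⟨ cong (_* N ^ l) (m+n∸n≡m 1 l) ⟩
    1 * N ^ l                                                ≡⟨ *-identityˡ (N ^ l) ⟩
    N * N ^ l-1                                              ∎)
    where
    l = suc l-1
    N = suc l
    c₀ = countCyclic N (just (empty N)) l (vacant 0)
    vacant-first : c₀ ≡ pf l l
    vacant-first = begin
      c₀                                                               ≡⟨ countCyclic-vacant-uniform l l l ≤-refl ⟨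
      countCyclic N (just (empty N)) l (vacant l)                      ≡⟨ cong (λ X → countCyclic N (just X) l (vacant l)) (empty-snoc l) ⟩
      countCyclic N (just (empty l ++ false ∷ [])) l (vacant l)        ≡⟨ countCyclic-vacant-last l l (empty l) (length-empty l) ⟩
      pf l l                                                           ∎

  ≤ᵇ-true : ∀ {m n} → m ≤ n → (m ≤ᵇ n) ≡ true
  ≤ᵇ-true m≤n = Equivalence.to T-≡ (≤⇒≤ᵇ m≤n)

  ≤ᵇ-false : ∀ m n → n < m → (m ≤ᵇ n) ≡ false
  ≤ᵇ-false m n n<m with m ≤ᵇ n | ≤ᵇ⇒≤ m n
  ... | false | _     = refl
  ... | true  | m≤n   = contradiction (m≤n _) (<⇒≱ n<m)

  ≡ᵇ-true : ∀ n → (n ≡ᵇ n) ≡ true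
  ≡ᵇ-true n = Equivalence.to T-≡ (≡⇒≡ᵇ n n refl)

  ≡ᵇ-false : ∀ m n → m ≢ n → (m ≡ᵇ n) ≡ false
  ≡ᵇ-false m n m≢n with m ≡ᵇ n | ≡ᵇ⇒≡ m n
  ... | false | _   = refl
  ... | true  | m≡n = contradiction (m≡n _) m≢n

  countWhere : (List ℕ → Bool) → List (List ℕ) → ℕ
  countWhere q xs = length (filter (λ x → T? (q x)) xs)

  countWhere-++ : ∀ q xs ys → countWhere q (xs ++ ys) ≡ countWhere q xs + countWhere q ys
  countWhere-++ q xs ys = trans (cong length (filter-++ (λ x → T? (q x)) xs ys)) (length-++ (filter (λ x → T? (q x)) xs))

  countWhere-map : ∀ q (f : List ℕ → List ℕ) xs → countWhere q (map f xs) ≡ countWhere (λ x → q (f x)) xs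
  countWhere-map q f []       = refl
  countWhere-map q f (x ∷ xs) with q (f x)
  ... | true  = cong suc (countWhere-map q f xs)
  ... | false = countWhere-map q f xs

  countWhere-cong : ∀ {q q′ : List ℕ → Bool} xs → (∀ x → q x ≡ q′ x) → countWhere q xs ≡ countWhere q′ xs
  countWhere-cong                []       h = refl
  countWhere-cong {q} {q′} (x ∷ xs) h with q x | q′ x | h x
  ... | true  | .true  | refl = cong suc (countWhere-cong xs h)
  ... | false | .false | refl = countWhere-cong xs h

  countWhere-false : ∀ xs → countWhere (const false) xs ≡ 0
  countWhere-false []       = refl
  countWhere-false (_ ∷ xs) = countWhere-false xs

  countWhere-range : ∀ s (f : ℕ → List (List ℕ)) q →
                     countWhere q (concatMap f (range1 s)) ≡ Σ< s (λ i → countWhere q (f (suc i)))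
  countWhere-range zero    f q = refl
  countWhere-range (suc s) f q = begin
    countWhere q (concatMap f (range1 s ++ suc s ∷ []))
      ≡⟨ cong (countWhere q) (concatMap-++ f (range1 s) (suc s ∷ [])) ⟩
    countWhere q (concatMap f (range1 s) ++ (f (suc s) ++ []))
      ≡⟨ countWhere-++ q (concatMap f (range1 s)) _ ⟩
    countWhere q (concatMap f (range1 s)) + countWhere q (f (suc s) ++ [])
      ≡⟨ cong₂ _+_ (countWhere-range s f q) (cong (countWhere q) (++-identityʳ (f (suc s)))) ⟩
    Σ< s (λ i → countWhere q (f (suc i))) + countWhere q (f (suc s)) ∎

  allParkFrom : Maybe (List Bool) → List ℕ → Bool
  allParkFrom nothing  _  = false
  allParkFrom (just X) as = allPark X as

  allPark-cons : ∀ X a as → allPark X (a ∷ as) ≡ allParkFrom (park X a) as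
  allPark-cons X a as with park X a
  ... | nothing = refl
  ... | just _  = refl

  countWhere-seqs : ∀ m n mX →
                    countWhere (λ as → isPrefSet m as ∧ allParkFrom mX as) (seqs n m) ≡ count m mX n (const 1)
  countWhere-seqs m n       nothing  =
    trans (countWhere-cong (seqs n m) (λ as → ∧-zeroʳ (isPrefSet m as))) (countWhere-false (seqs n m))
  countWhere-seqs m zero    (just X) = refl
  countWhere-seqs m (suc n) (just X) = trans (countWhere-range m (λ a → map (a ∷_) (seqs n m)) _)
    (Σ-cong m (λ i i<m → trans (countWhere-map _ (suc i ∷_) (seqs n m))
      (trans (countWhere-cong (seqs n m) (λ as →
                cong₂ (λ b c → (b ∧ isPrefSet m as) ∧ c) (≤ᵇ-true i<m) (allPark-cons X (suc i) as)))
             (countWhere-seqs m n (park X (suc i))))))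

  pPF≡pfFirst : ∀ r j m → r < m → pPF (suc r) (suc j) m m ≡ pfFirst m (suc r) j
  pPF≡pfFirst r j m r<m = begin
    pPF (suc r) (suc j) m m
      ≡⟨ countWhere-range m (λ a → map (a ∷_) (seqs j m)) _ ⟩
    Σ< m (λ i → countWhere Q (map (suc i ∷_) (seqs j m)))
      ≡⟨ Σ-single m r _ r<m other-first ⟩
    countWhere Q (map (suc r ∷_) (seqs j m))
      ≡⟨ countWhere-map _ (suc r ∷_) (seqs j m) ⟩
    countWhere (λ as → Q (suc r ∷ as)) (seqs j m)
      ≡⟨ countWhere-cong (seqs j m) (λ as →
           cong₂ (λ a c → a ∧ ((true ∧ c) ∧ isPrefSet m as) ∧ allPark (empty m) (suc r ∷ as)) (≡ᵇ-true r) (≤ᵇ-true r<m)) ⟩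
    countWhere (λ as → isPrefSet m as ∧ allPark (empty m) (suc r ∷ as)) (seqs j m)
      ≡⟨ countWhere-cong (seqs j m) (λ as → cong (isPrefSet m as ∧_) (allPark-cons (empty m) (suc r) as)) ⟩
    countWhere (λ as → isPrefSet m as ∧ allParkFrom (park (empty m) (suc r)) as) (seqs j m)
      ≡⟨ countWhere-seqs m j (park (empty m) (suc r)) ⟩
    pfFirst m (suc r) j ∎
    where
    Q : List ℕ → Bool
    Q as = firstIs (suc r) as ∧ isPrefSet m as ∧ allPark (empty m) as
    other-first : ∀ i → i < m → i ≢ r → countWhere Q (map (suc i ∷_) (seqs j m)) ≡ 0
    other-first i _ i≢r = trans (countWhere-map _ (suc i ∷_) (seqs j m))
      (trans (countWhere-cong (seqs j m) (λ as →
                cong (_∧ (isPrefSet m (suc i ∷ as) ∧ allPark (empty m) (suc i ∷ as))) (≡ᵇ-false r i (≢-sym i≢r))))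
             (countWhere-false (seqs j m)))

open import Defs
open import Data.Nat using (ℕ; zero; suc; _≤_; _<_; _∸_; _!)
import Data.Nat as ℕ
import Data.Nat.Properties as ℕₚ
open import Data.Nat.Combinatorics using (_C_)
open import Data.Integer using (+_)
import Data.Integer as ℤ
import Data.Integer.Properties as ℤₚ
open import Data.Integer.GCD using (gcd)
open import Data.Integer.Solver using () renaming (module +-*-Solver to ℤ-Solver)
open import Data.Rational using (ℚ; mkℚ; _/_; _+_; _-_; _*_; 0ℚ; 1ℚ; toℚᵘ)
import Data.Rational.Properties as ℚₚ
open import Data.Rational.Unnormalised using (ℚᵘ; mkℚᵘ; *≡*) renaming (_≃_ to _≃ᵘ_)
import Data.Rational.Unnormalised.Properties as ℚᵘₚ
open import Data.Rational.Solver using () renaming (module +-*-Solver to ℚ-Solver)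
open import Data.Product using (_×_; _,_)
open import Relation.Binary.PropositionalEquality using (_≡_; _≢_; refl; sym; trans; cong; cong₂; module ≡-Reasoning)
open import Relation.Binary.Definitions using (tri<; tri≈; tri>)
open ≡-Reasoning
open Counting
  using (Σ<; Σ-single; nCk*k!*[n∸k]!≡n!; pf; pfFirst; pf-cayley; pf-decompose; pfFirst-last; pfFirst-step; pfFirst-flat;
         pPF≡pfFirst; ≤ᵇ-true; ≤ᵇ-false; ≡ᵇ-true; ≡ᵇ-false)

-- Exponential generating functions

ι : ℕ → ℚ
ι a = (+ a) / 1

toℚᵘ-/ : ∀ i n .{{_ : ℕ.NonZero n}} → toℚᵘ (i / n) ≃ᵘ mkℚᵘ i (ℕ.pred n)
toℚᵘ-/ i (suc n) with i / suc n | ℚₚ.↥-/ i (suc n) | ℚₚ.↧-/ i (suc n)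
... | mkℚ p d-1 _ | ↥p*g≡i | ↧p*g≡n = *≡* (begin
  p ℤ.* + suc n                 ≡⟨ cong (p ℤ.*_) ↧p*g≡n ⟨
  p ℤ.* (+ suc d-1 ℤ.* g)        ≡⟨ rearrange p (+ suc d-1) g ⟩
  (p ℤ.* g) ℤ.* + suc d-1        ≡⟨ cong (ℤ._* + suc d-1) ↥p*g≡i ⟩
  i ℤ.* + suc d-1                ∎)
  where
  g = gcd i (+ suc n)
  open ℤ-Solver
  rearrange : ∀ a b c → a ℤ.* (b ℤ.* c) ≡ (a ℤ.* c) ℤ.* b
  rearrange = solve 3 (λ a b c → a :* (b :* c) := (a :* c) :* b) refl

≡-via-ℚᵘ : ∀ {x y : ℚ} (z : ℚᵘ) → toℚᵘ x ≃ᵘ z → toℚᵘ y ≃ᵘ z → x ≡ y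
≡-via-ℚᵘ z x≃z y≃z = ℚₚ.toℚᵘ-injective (ℚᵘₚ.≃-trans x≃z (ℚᵘₚ.≃-sym y≃z))

ι-ℚᵘ : ∀ a → toℚᵘ (ι a) ≃ᵘ mkℚᵘ (+ a) 0
ι-ℚᵘ a = toℚᵘ-/ (+ a) 1

ι-+ : ∀ a b → ι (a ℕ.+ b) ≡ ι a + ι b
ι-+ a b = ≡-via-ℚᵘ (mkℚᵘ (+ (a ℕ.+ b)) 0) (ι-ℚᵘ (a ℕ.+ b))
  (ℚᵘₚ.≃-trans (ℚₚ.toℚᵘ-homo-+ (ι a) (ι b)) (ℚᵘₚ.≃-trans (ℚᵘₚ.+-cong (ι-ℚᵘ a) (ι-ℚᵘ b))
    (*≡* (trans (over-one (+ a) (+ b)) (cong (ℤ._* + 1) (sym (ℤₚ.pos-+ a b)))))))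
  where
  open ℤ-Solver
  over-one : ∀ x y → (x ℤ.* + 1 ℤ.+ y ℤ.* + 1) ℤ.* + 1 ≡ (x ℤ.+ y) ℤ.* + 1
  over-one = solve 2 (λ x y → (x :* con (+ 1) :+ y :* con (+ 1)) :* con (+ 1) := (x :+ y) :* con (+ 1)) refl

ι-* : ∀ a b → ι (a ℕ.* b) ≡ ι a * ι b
ι-* a b = ≡-via-ℚᵘ (mkℚᵘ (+ (a ℕ.* b)) 0) (ι-ℚᵘ (a ℕ.* b))
  (ℚᵘₚ.≃-trans (ℚₚ.toℚᵘ-homo-* (ι a) (ι b)) (ℚᵘₚ.≃-trans (ℚᵘₚ.*-cong (ι-ℚᵘ a) (ι-ℚᵘ b))
    (*≡* (cong (ℤ._* + 1) (sym (ℤₚ.pos-* a b))))))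

ι-*-inverse : ∀ n .{{_ : ℕ.NonZero n}} → ι n * ((+ 1) / n) ≡ 1ℚ
ι-*-inverse (suc n) = ≡-via-ℚᵘ (mkℚᵘ (+ 1) 0)
  (ℚᵘₚ.≃-trans (ℚₚ.toℚᵘ-homo-* (ι (suc n)) ((+ 1) / suc n))
    (ℚᵘₚ.≃-trans (ℚᵘₚ.*-cong (ι-ℚᵘ (suc n)) (toℚᵘ-/ (+ 1) (suc n))) (*≡* (begin
      (+ suc n ℤ.* + 1) ℤ.* + 1   ≡⟨ ℤₚ.*-identityʳ _ ⟩
      + suc n ℤ.* + 1             ≡⟨ ℤₚ.*-identityʳ _ ⟩
      + suc n                     ≡⟨ cong (λ z → + suc z) (ℕₚ.+-identityʳ n) ⟨
      + suc (n ℕ.+ 0)             ≡⟨ ℤₚ.*-identityˡ _ ⟨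
      + 1 ℤ.* + suc (n ℕ.+ 0)     ∎))))
  ℚᵘₚ.≃-refl

ι!-*-inv! : ∀ n → ι (n !) * inv! n ≡ 1ℚ
ι!-*-inv! n = ι-*-inverse (n !) {{ℕₚ._!≢0 n}}

inv!-*-inv! : ∀ i j → i ≤ j → inv! i * inv! (j ∸ i) ≡ ι (j C (j ∸ i)) * inv! j
inv!-*-inv! i j i≤j = begin
  u * v                          ≡⟨ ℚₚ.*-identityʳ (u * v) ⟨
  (u * v) * 1ℚ                   ≡⟨ cong ((u * v) *_) (ι!-*-inv! j) ⟨
  (u * v) * (ι (j !) * w)        ≡⟨ cong (λ z → (u * v) * (z * w)) binomial ⟨
  (u * v) * ((c * (J * I)) * w)  ≡⟨ rearrange u v w c I J ⟩
  (c * w) * ((I * u) * (J * v))  ≡⟨ cong₂ (λ a b → (c * w) * (a * b)) (ι!-*-inv! i) (ι!-*-inv! (j ∸ i)) ⟩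
  (c * w) * (1ℚ * 1ℚ)            ≡⟨ ℚₚ.*-identityʳ (c * w) ⟩
  c * w                          ∎
  where
  u = inv! i
  v = inv! (j ∸ i)
  w = inv! j
  I = ι (i !)
  J = ι ((j ∸ i) !)
  c = ι (j C (j ∸ i))
  binomial : c * (J * I) ≡ ι (j !)
  binomial = begin
    c * (J * I)                                        ≡⟨ cong (c *_) (ι-* ((j ∸ i) !) (i !)) ⟨
    c * ι ((j ∸ i) ! ℕ.* i !)                          ≡⟨ ι-* (j C (j ∸ i)) _ ⟨
    ι ((j C (j ∸ i)) ℕ.* ((j ∸ i) ! ℕ.* i !))
      ≡⟨ cong (λ z → ι ((j C (j ∸ i)) ℕ.* ((j ∸ i) ! ℕ.* z !))) (ℕₚ.m∸[m∸n]≡n i≤j) ⟨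
    ι ((j C (j ∸ i)) ℕ.* ((j ∸ i) ! ℕ.* (j ∸ (j ∸ i)) !))
      ≡⟨ cong ι (nCk*k!*[n∸k]!≡n! (ℕₚ.m∸n≤m j i)) ⟩
    ι (j !) ∎
  open ℚ-Solver
  rearrange : ∀ u v w c I J → (u * v) * ((c * (J * I)) * w) ≡ (c * w) * ((I * u) * (J * v))
  rearrange = solve 6 (λ u v w c I J → (u :* v) :* ((c :* (J :* I)) :* w) := (c :* w) :* ((I :* u) :* (J :* v))) refl

egf-split : ∀ B c V P w u v → u * v ≡ ι c * w →
  ι (B ℕ.+ c ℕ.* (V ℕ.* P)) * w ≡ (ι B * w - 0ℚ) + (ι P * u) * (ι V * v)
egf-split B c V P w u v uv≡cw = begin
  ι (B ℕ.+ c ℕ.* (V ℕ.* P)) * w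
    ≡⟨ cong (_* w) (trans (ι-+ B _) (cong (λ z → ι B + z) (trans (ι-* c _) (cong (ι c *_) (ι-* V P))))) ⟩
  (ι B + ι c * (ι V * ι P)) * w
    ≡⟨ solve 5 (λ B c V P w → (B :+ c :* (V :* P)) :* w := B :* w :+ (P :* V) :* (c :* w)) refl (ι B) (ι c) (ι V) (ι P) w ⟩
  ι B * w + (ι P * ι V) * (ι c * w)
    ≡⟨ cong (λ z → ι B * w + (ι P * ι V) * z) uv≡cw ⟨
  ι B * w + (ι P * ι V) * (u * v)
    ≡⟨ solve 5 (λ B P V u v → B :+ (P :* V) :* (u :* v) := (B :- con 0ℚ) :+ (P :* u) :* (V :* v)) refl (ι B * w) (ι P) (ι V) u v ⟩
  (ι B * w - 0ℚ) + (ι P * u) * (ι V * v) ∎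
  where open ℚ-Solver

sumTo-cong : ∀ j (f g : ℕ → ℚ) → (∀ i → i ≤ j → f i ≡ g i) → sumTo j f ≡ sumTo j g
sumTo-cong zero    f g h = h 0 ℕ.z≤n
sumTo-cong (suc j) f g h = cong₂ _+_ (sumTo-cong j f g (λ i i≤j → h i (ℕₚ.m≤n⇒m≤1+n i≤j))) (h (suc j) ℕₚ.≤-refl)

sumTo-ι : ∀ j (h : ℕ → ℕ) w → sumTo j (λ i → ι (h i) * w) ≡ ι (Σ< (suc j) h) * w
sumTo-ι zero    h w = refl
sumTo-ι (suc j) h w = trans (cong (_+ ι (h (suc j)) * w) (sumTo-ι j h w))
  (trans (sym (ℚₚ.*-distribʳ-+ w (ι (Σ< (suc j) h)) (ι (h (suc j)))))
         (cong (_* w) (sym (ι-+ (Σ< (suc j) h) (h (suc j))))))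

⊛-egf : ∀ j (a b : ℕ → ℕ) (F G : Series) → (∀ i → F i ≡ ι (a i) * inv! i) → (∀ t → G t ≡ ι (b t) * inv! t) →
        (F ⊛ G) j ≡ ι (Σ< (suc j) (λ i → (j C (j ∸ i)) ℕ.* (b (j ∸ i) ℕ.* a i))) * inv! j
⊛-egf j a b F G F≡ G≡ = trans (sumTo-cong j _ _ term) (sumTo-ι j _ (inv! j))
  where
  open ℚ-Solver
  term : ∀ i → i ≤ j → F i * G (j ∸ i) ≡ ι ((j C (j ∸ i)) ℕ.* (b (j ∸ i) ℕ.* a i)) * inv! j
  term i i≤j = begin
    F i * G (j ∸ i)
      ≡⟨ cong₂ _*_ (F≡ i) (G≡ (j ∸ i)) ⟩
    (A * inv! i) * (B * inv! (j ∸ i))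
      ≡⟨ solve 4 (λ A u B v → (A :* u) :* (B :* v) := (B :* A) :* (u :* v)) refl A (inv! i) B (inv! (j ∸ i)) ⟩
    (B * A) * (inv! i * inv! (j ∸ i))
      ≡⟨ cong₂ _*_ (sym (ι-* (b (j ∸ i)) (a i))) (inv!-*-inv! i j i≤j) ⟩
    ι (b (j ∸ i) ℕ.* a i) * (c * inv! j)
      ≡⟨ solve 3 (λ X c w → X :* (c :* w) := (c :* X) :* w) refl (ι (b (j ∸ i) ℕ.* a i)) c (inv! j) ⟩
    (c * ι (b (j ∸ i) ℕ.* a i)) * inv! j
      ≡⟨ cong (_* inv! j) (ι-* (j C (j ∸ i)) _) ⟨
    ι ((j C (j ∸ i)) ℕ.* (b (j ∸ i) ℕ.* a i)) * inv! j ∎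
    where
    A = ι (a i)
    B = ι (b (j ∸ i))
    c = ι (j C (j ∸ i))

Pser-pf : ∀ i → Pser i ≡ ι (pf i i) * inv! i
Pser-pf i = cong (λ z → ι z * inv! i) (sym (pf-cayley i))

δ₀ : ℕ → ℕ
δ₀ zero    = 1
δ₀ (suc _) = 0

oneS-egf : ∀ t → oneS t ≡ ι (δ₀ t) * inv! t
oneS-egf zero    = refl
oneS-egf (suc t) = sym (ℚₚ.*-zeroˡ (inv! (suc t)))

Pser^-pf : ∀ k j → (Pser ^S suc k) j ≡ ι (pf (j ℕ.+ k) j) * inv! j
Pser^-pf zero    j = trans (⊛-egf j (λ i → pf i i) δ₀ Pser oneS Pser-pf oneS-egf)
  (cong (λ z → ι z * inv! j) (trans (Σ-single (suc j) j _ ℕₚ.≤-refl below-j) (begin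
    (j C (j ∸ j)) ℕ.* (δ₀ (j ∸ j) ℕ.* pf j j)  ≡⟨ cong (λ z → (j C z) ℕ.* (δ₀ z ℕ.* pf j j)) (ℕₚ.n∸n≡0 j) ⟩
    1 ℕ.* (1 ℕ.* pf j j)                      ≡⟨ trans (ℕₚ.*-identityˡ _) (ℕₚ.*-identityˡ _) ⟩
    pf j j                                    ≡⟨ cong (λ z → pf z j) (ℕₚ.+-identityʳ j) ⟨
    pf (j ℕ.+ 0) j                            ∎)))
  where
  below-j : ∀ i → i < suc j → i ≢ j → (j C (j ∸ i)) ℕ.* (δ₀ (j ∸ i) ℕ.* pf i i) ≡ 0
  below-j i i<1+j i≢j = trans
    (cong (λ z → (j C (j ∸ i)) ℕ.* (δ₀ z ℕ.* pf i i)) (ℕₚ.+-∸-assoc 1 (ℕₚ.≤∧≢⇒< (ℕ.s≤s⁻¹ i<1+j) i≢j)))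
    (ℕₚ.*-zeroʳ (j C (j ∸ i)))
Pser^-pf (suc k) j = trans (⊛-egf j (λ i → pf i i) (λ t → pf (t ℕ.+ k) t) Pser (Pser ^S suc k) Pser-pf (Pser^-pf k))
  (cong (λ z → ι z * inv! j) (trans (sym (pf-decompose j k)) (cong (λ z → pf z j) (sym (ℕₚ.+-suc j k)))))

H-below : ∀ l k n → n ≤ l → H l k n ≡ 0ℚ
H-below l k n n≤l rewrite ≤ᵇ-false (suc l) n (ℕ.s≤s n≤l) = refl

H-above : ∀ l k j → l ≤ j → H l k (suc j) ≡ ι (pfFirst (suc (j ℕ.+ k)) (suc (j ∸ l ℕ.+ k)) j) * inv! j
H-above l k j l≤j rewrite ≤ᵇ-true (ℕ.s≤s l≤j) = cong (λ z → ι z * inv! j) (begin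
  pPF (suc j ℕ.+ k ∸ l) (suc j) m m
    ≡⟨ cong (λ r → pPF r (suc j) m m) first-preference ⟩
  pPF (suc (j ∸ l ℕ.+ k)) (suc j) m m
    ≡⟨ pPF≡pfFirst (j ∸ l ℕ.+ k) j m (ℕ.s≤s (ℕₚ.+-monoˡ-≤ k (ℕₚ.m∸n≤m j l))) ⟩
  pfFirst m (suc (j ∸ l ℕ.+ k)) j ∎)
  where
  m = suc j ℕ.+ k
  first-preference : suc j ℕ.+ k ∸ l ≡ suc (j ∸ l ℕ.+ k)
  first-preference = trans (ℕₚ.+-∸-comm k (ℕₚ.m≤n⇒m≤1+n l≤j)) (cong (ℕ._+ k) (ℕₚ.+-∸-assoc 1 l≤j))

mono-≢ : ∀ c j n → j ≢ n → mono c j n ≡ 0ℚ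
mono-≢ c j n j≢n rewrite ≡ᵇ-false j n j≢n = refl

mono-≡ : ∀ c j → mono c j j ≡ c
mono-≡ c j rewrite ≡ᵇ-true j = refl

shiftS-< : ∀ j (f : Series) n → n < j → shiftS j f n ≡ 0ℚ
shiftS-< j f n n<j rewrite ≤ᵇ-false j n n<j = refl

shiftS-≥ : ∀ j (f : Series) n → j ≤ n → shiftS j f n ≡ f (n ∸ j)
shiftS-≥ j f n j≤n rewrite ≤ᵇ-true j≤n = refl

H-zero : ∀ k n → H 0 k n ≡ shiftS 1 (Pser ^S suc k) n
H-zero k zero    = refl
H-zero k (suc j) = trans (H-above 0 k j ℕ.z≤n) (trans (cong (λ z → ι z * inv! j) (pfFirst-last j k)) (sym (Pser^-pf k j)))

module _ (k l-1 : ℕ) where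
  private
    l = suc l-1
    c = ι (pPF 1 l (l ℕ.+ k) (l ℕ.+ k)) * inv! l-1
    g : Series
    g n = (ι (pL l) * inv! l) * (Pser ^S suc k) n

  H-recurrence-below : ∀ n → n < l → H l k n ≡ ((H l-1 k ⊖ mono c l) ⊕ shiftS (suc l) g) n
  H-recurrence-below n n<l = begin
    H l k n          ≡⟨ H-below l k n (ℕₚ.<⇒≤ n<l) ⟩
    0ℚ               ≡⟨⟩
    (0ℚ - 0ℚ) + 0ℚ   ≡⟨ cong₂ _+_ (cong₂ _-_ (H-below l-1 k n (ℕ.s≤s⁻¹ n<l)) (mono-≢ c l n (ℕₚ.>⇒≢ n<l)))
                               (shiftS-< (suc l) g n (ℕₚ.m<n⇒m<1+n n<l)) ⟨
    ((H l-1 k ⊖ mono c l) ⊕ shiftS (suc l) g) n ∎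

  H-recurrence-at : H l k l ≡ ((H l-1 k ⊖ mono c l) ⊕ shiftS (suc l) g) l
  H-recurrence-at = begin
    H l k l        ≡⟨ H-below l k l ℕₚ.≤-refl ⟩
    0ℚ             ≡⟨ ℚₚ.+-inverseʳ c ⟨
    c - c          ≡⟨ ℚₚ.+-identityʳ (c - c) ⟨
    (c - c) + 0ℚ   ≡⟨ cong₂ _+_ (cong₂ _-_ H-previous (mono-≡ c l)) (shiftS-< (suc l) g l (ℕₚ.n<1+n l)) ⟨
    ((H l-1 k ⊖ mono c l) ⊕ shiftS (suc l) g) l ∎
    where
    m = suc (l-1 ℕ.+ k)
    H-previous : H l-1 k l ≡ c
    H-previous = trans (H-above l-1 k l-1 ℕₚ.≤-refl) (cong (λ z → ι z * inv! l-1) (begin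
      pfFirst m (suc (l-1 ∸ l-1 ℕ.+ k)) l-1  ≡⟨ cong (λ z → pfFirst m (suc (z ℕ.+ k)) l-1) (ℕₚ.n∸n≡0 l-1) ⟩
      pfFirst m (suc k) l-1                   ≡⟨ pfFirst-flat l-1 k ⟨
      pfFirst m 1 l-1                         ≡⟨ pPF≡pfFirst 0 l-1 m (ℕ.s≤s ℕ.z≤n) ⟨
      pPF 1 l m m                             ∎))

  H-recurrence-above : ∀ j → l ≤ j → H l k (suc j) ≡ ((H l-1 k ⊖ mono c l) ⊕ shiftS (suc l) g) (suc j)
  H-recurrence-above j l≤j = begin
    H l k (suc j)
      ≡⟨ H-above l k j l≤j ⟩
    ι (pfFirst m (suc (j ∸ l ℕ.+ k)) j) * w
      ≡⟨ cong (λ z → ι z * w) (trans (pfFirst-step j k l l≤j)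
                                     (cong (λ z → B ℕ.+ (j C (j ∸ l)) ℕ.* (V ℕ.* z)) (pf-cayley l))) ⟩
    ι (B ℕ.+ (j C (j ∸ l)) ℕ.* (V ℕ.* pL l)) * w
      ≡⟨ egf-split B (j C (j ∸ l)) V (pL l) w (inv! l) (inv! (j ∸ l)) (inv!-*-inv! l j l≤j) ⟩
    (ι B * w - 0ℚ) + (ι (pL l) * inv! l) * (ι V * inv! (j ∸ l))
      ≡⟨ cong₂ _+_ (cong₂ _-_ H-previous (mono-≢ c l (suc j) (ℕₚ.<⇒≢ (ℕ.s≤s l≤j)))) shifted ⟨
    ((H l-1 k ⊖ mono c l) ⊕ shiftS (suc l) g) (suc j) ∎
    where
    m = suc (j ℕ.+ k)
    w = inv! j
    B = pfFirst m (suc (suc (j ∸ l ℕ.+ k))) j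
    V = pf (j ∸ l ℕ.+ k) (j ∸ l)
    H-previous : H l-1 k (suc j) ≡ ι B * w
    H-previous = trans (H-above l-1 k j (ℕₚ.<⇒≤ l≤j))
      (cong (λ z → ι (pfFirst m (suc (z ℕ.+ k)) j) * w) (ℕₚ.+-∸-assoc 1 l≤j))
    shifted : shiftS (suc l) g (suc j) ≡ (ι (pL l) * inv! l) * (ι V * inv! (j ∸ l))
    shifted = trans (shiftS-≥ (suc l) g (suc j) (ℕ.s≤s l≤j)) (cong ((ι (pL l) * inv! l) *_) (Pser^-pf k (j ∸ l)))

  H-recurrence : ∀ n → H l k n ≡ ((H l-1 k ⊖ mono c l) ⊕ shiftS (suc l) g) n
  H-recurrence n with ℕₚ.<-cmp n l
  ... | tri< n<l _ _ = H-recurrence-below n n<l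
  ... | tri≈ _ refl _ = H-recurrence-at
  H-recurrence (suc j) | tri> _ _ (ℕ.s≤s l≤j) = H-recurrence-above j l≤j

theorem7p2 : (k : ℕ) →
    ((n : ℕ) → H 0 k n ≡ shiftS 1 (Pser ^S suc k) n)
    × ((l : ℕ) → 1 ≤ l → (n : ℕ) →
        H l k n ≡ ((H (l ∸ 1) k ⊖ mono ((+ pPF 1 l (l Data.Nat.+ k) (l Data.Nat.+ k)) / 1 * inv! (l ∸ 1)) l)
                   ⊕ shiftS (suc l) (λ m → ((+ pL l) / 1 * inv! l) * (Pser ^S suc k) m)) n)
theorem7p2 k = H-zero k , λ { (suc l-1) _ → H-recurrence k l-1 }
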